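{- For every integer $k\ge 1$ and every $\ell\in\{3,4,\dots,k+5\}$, there exists a perfect acyclic matching on $A_k^{1,\ell}$ (regarded as a subposet of the face poset of $\mathcal{N}(S_{3,k})$, ordered by inclusion).
   Context: For a positive integer $n$, $[n]=\{1,\dots,n\}$. $KG_{3,k}$ has as vertices the $3$-element subsets of $[k+6]$, adjacent iff disjoint. A vertex $v$ is stable if there is no $t\in[k+6]$ with $\{t,t+1\}\subseteq v$ (addition mod $k+6$, so $\{k+6,1\}$ counts), unstable otherwise. $S_{3,k}$ has the same vertices as $KG_{3,k}$ and the edges of $KG_{3,k}$ with at least one stable endpoint. $\mathcal{N}(S_{3,k})$ is the neighborhood complex: simplices are nonempty vertex sets with a common neighbor in $S_{3,k}$. For a set $\sigma$ of vertices, $C_\sigma=[k+6]\setminus\bigcup_{\alpha\in\sigma}\alpha$, and $A_k^{1,\ell}=\{\sigma\in\mathcal{N}(S_{3,k}) : C_\sigma=\{1,2,\ell\}\}$. A matching on a poset $P$ is a set $M$ of pairs $(a,b)$ of elements of $P$ with $b$ covering $a$, each element of $P$ lying in at most one pair; write $u(a)=b$ for $(a,b)\in M$. It is acyclic if there are no distinct $a_1,\dots,a_m\in P$, $m\ge 2$, with $a_1\prec u(a_1)\succ a_2\prec u(a_2)\succ\cdots\prec u(a_m)\succ a_1$. It is perfect if every element of $P$ belongs to some pair of $M$. -}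

module Defs where

open import Data.Nat using (ℕ; zero; suc; _+_; _≤_; _<_; NonZero)
open import Data.Nat.DivMod using (_%_; m%n<n)
open import Data.Nat.Properties using (_≟_)
open import Data.Bool using (Bool)
open import Data.Fin using (Fin; toℕ; fromℕ<)
open import Data.Fin.Subset using (Subset; inside; outside; _∈_; _⊆_; _⊂_; ∣_∣; Nonempty)
open import Data.List using (List; []; _∷_; [_]; _++_; map; filter; length; lookup)
open import Data.List.Membership.Propositional renaming (_∈_ to _∈ₗ_)
open import Data.Vec using ([]; _∷_)
open import Data.Product using (Σ; ∃; ∃-syntax; _×_; _,_; proj₁; proj₂)
open import Data.Sum using (_⊎_)
open import Data.Empty using (⊥)
open import Relation.Nullary using (¬_)
open import Relation.Binary.PropositionalEquality using (_≡_)
open import Function.Bundles using (_⇔_)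

-- Conventions.  The ground set [n] = {1,…,n} is represented by Fin n,
-- the element i ∈ [n] being the Fin-index with toℕ = i - 1, i.e. the
-- "label" of x : Fin n is  suc (toℕ x).

label : ∀ {n} → Fin n → ℕ
label x = suc (toℕ x)

next : ∀ {m} → Fin (suc m) → Fin (suc m)
next {m} t = fromℕ< (m%n<n (suc (toℕ t)) (suc m))

-- Vertices of KG_{3,k}: the 3-element subsets of [n], n = 6 + k.
-- We enumerate all subsets of Fin n, keep those of size 3, and index
-- vertices by positions in that list (each 3-subset occurs exactly once),
-- so that sets of vertices are canonical (Subset of the vertex index set).

allSubsets : (n : ℕ) → List (Subset n)
allSubsets zero    = [ [] ]
allSubsets (suc n) = map (outside ∷_) (allSubsets n) ++ map (inside ∷_) (allSubsets n)

triples : (n : ℕ) → List (Subset n)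
triples n = filter (λ s → ∣ s ∣ ≟ 3) (allSubsets n)

NV : ℕ → ℕ
NV k = length (triples (6 + k))

Vertex : ℕ → Set
Vertex k = Fin (NV k)

vset : ∀ k → Vertex k → Subset (6 + k)
vset k v = lookup (triples (6 + k)) v

Stable : ∀ k → Vertex k → Set
Stable k v = ¬ (∃[ t ] (t ∈ vset k v × next {5 + k} t ∈ vset k v))

Disjoint : ∀ {n} → Subset n → Subset n → Set
Disjoint p q = ∀ x → x ∈ p → x ∈ q → ⊥

AdjKG : ∀ k → Vertex k → Vertex k → Set
AdjKG k v w = Disjoint (vset k v) (vset k w)

AdjS : ∀ k → Vertex k → Vertex k → Set
AdjS k v w = AdjKG k v w × (Stable k v ⊎ Stable k w)

VSet : ℕ → Set
VSet k = Subset (NV k)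

InN : ∀ k → VSet k → Set
InN k σ = Nonempty σ × ∃[ w ] (∀ v → v ∈ σ → AdjS k v w)

-- membership in C_σ = [k+6] \ ⋃_{α∈σ} α
InC : ∀ k → Fin (6 + k) → VSet k → Set
InC k x σ = ¬ (∃[ v ] (v ∈ σ × x ∈ vset k v))

-- A_k^{1,ℓ} = { σ ∈ N(S_{3,k}) : C_σ = {1, 2, ℓ} }
InA : (k ℓ : ℕ) → VSet k → Set
InA k ℓ σ = InN k σ × (∀ (x : Fin (6 + k)) →
  InC k x σ ⇔ (label x ≡ 1 ⊎ label x ≡ 2 ⊎ label x ≡ ℓ))

Covers : ∀ k → (VSet k → Set) → VSet k → VSet k → Set
Covers k P a b = P a × P b × a ⊂ b × ¬ (∃[ c ] (P c × a ⊂ c × c ⊂ b))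

Pair : ℕ → Set
Pair k = VSet k × VSet k

IsMatching : ∀ k → (VSet k → Set) → List (Pair k) → Set
IsMatching k P M =
  (∀ {p} → p ∈ₗ M → Covers k P (proj₁ p) (proj₂ p)) ×
  (∀ {p q : Pair k} (x : VSet k) → p ∈ₗ M → q ∈ₗ M →
     (x ≡ proj₁ p ⊎ x ≡ proj₂ p) → (x ≡ proj₁ q ⊎ x ≡ proj₂ q) → p ≡ q)

IsPerfect : ∀ k → (VSet k → Set) → List (Pair k) → Set
IsPerfect k P M =
  ∀ (x : VSet k) → P x → ∃[ p ] (p ∈ₗ M × (x ≡ proj₁ p ⊎ x ≡ proj₂ p))

IsAcyclic : ∀ k → (VSet k → Set) → List (Pair k) → Set
IsAcyclic k P M =
  ∀ (j : ℕ) (a u : Fin (suc (suc j)) → VSet k) →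
    (∀ i → (a i , u i) ∈ₗ M) →
    (∀ i → Covers k P (a (next i)) (u i)) →
    (∀ i i′ → a i ≡ a i′ → i ≡ i′) →
    ⊥

module Submission where

-- Write ℓ = j + 3 and let W₀ be the set of points of [k+6] whose label is not 1, 2 or ℓ.
-- The sets σ in A_k^{1,ℓ} are exactly the stable covers of W₀: nonempty sets of stable vertices
-- inside W₀ whose union is W₀ (a common neighbour must be the unstable vertex {1 , 2 , ℓ}, so
-- every vertex of σ is stable).  Stable covers of a region W are matched by the element
-- matching along a stable vertex t ⊆ W with W ⊄ t, pairing σ with σ ∪ {t}; the covers σ ∋ t for
-- which σ - t no longer covers W are τ ∪ {t} with τ a stable cover of W ∖ D for a nonempty part
-- D of t, and they are matched by lifting matchings of the smaller regions W ∖ D.  Keeping all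
-- pairs elementary (adding one vertex) is what makes acyclicity survive the lifting.

open import Defs
open import Data.Nat using (ℕ; zero; suc; _+_; _≤_; _<_; _∸_; z≤n; s≤s)
import Data.Nat.Properties as ℕP
open import Data.Nat.DivMod using (_%_; m<n⇒m%n≡m; n%n≡0)
open import Data.Bool using (true)
open import Data.Fin using (Fin; zero; suc; toℕ; fromℕ; fromℕ<; inject₁)
import Data.Fin.Properties as FinP
open import Data.Fin.Subset using (Subset; inside; outside; _∈_; _∉_; _⊆_; _⊂_; ∣_∣; Nonempty; ⁅_⁆; _∪_; _─_; _-_)
open import Data.Fin.Subset.Properties
  using (_∈?_; ⊆-refl; ⊆-trans; ⊆-antisym; x∈p∪q⁻; p⊆p∪q; q⊆p∪q; x∈⁅x⁆; x∈⁅y⁆⇒x≡y; x∉⁅y⁆⇒x≢y; p─q⊆p; x∈p∧x≢y⇒x∈p-y;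
         p─⊥≡p; Empty-unique; nonempty?; _⊆?_; ∣⊥∣≡0; x∈p⇒∣p-x∣<∣p∣; p⊂q⇒∣p∣<∣q∣; ∪-assoc; ∪-comm)
open import Data.List using (List; []; _∷_; _++_; length; map; filter; concatMap)
open import Data.List.Membership.Propositional using (find; lose) renaming (_∈_ to _∈ₗ_)
open import Data.List.Relation.Unary.Any using (here; there; index)
open import Data.List.Relation.Unary.Any.Properties using (lookup-index)
open import Data.List.Membership.Propositional.Properties using (∈-map⁺; ∈-map⁻; ∈-++⁺ˡ; ∈-++⁺ʳ; ∈-++⁻; ∈-filter⁺; ∈-filter⁻; ∈-concatMap⁺; ∈-concatMap⁻; ∈-lookup)
open import Data.Vec using ([]; _∷_; tabulate; here; there)
open import Data.Vec.Properties using (lookup∘tabulate; []=⇒lookup; lookup⇒[]=)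
open import Data.Product as Product using (∃-syntax; ∃₂; _×_; _,_; proj₁; proj₂)
open import Data.Sum as Sum using (_⊎_; inj₁; inj₂)
open import Data.Empty using (⊥; ⊥-elim)
open import Relation.Nullary using (¬_; Dec; yes; no; does)
open import Relation.Nullary.Decidable using (_×-dec_; _⊎-dec_; _→-dec_; ¬?; map′; dec-true; decidable-stable)
open import Relation.Unary using (Decidable)
open import Function.Bundles using (_⇔_; mk⇔; Equivalence)
open Equivalence using (to; from)
open import Function.Construct.Composition using (_⇔-∘_)
open import Function.Construct.Symmetry using (⇔-sym)
open import Relation.Binary.PropositionalEquality using (_≡_; _≢_; refl; sym; trans; cong; subst; subst₂; module ≡-Reasoning)

insert : ∀ {n} → Subset n → Fin n → Subset n
insert p x = p ∪ ⁅ x ⁆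

∈-insert⁻ : ∀ {n} (p : Subset n) x {y} → y ∈ insert p x → y ∈ p ⊎ y ≡ x
∈-insert⁻ p x y∈ = Sum.map₂ (x∈⁅y⁆⇒x≡y x) (x∈p∪q⁻ p ⁅ x ⁆ y∈)

⊆-insert : ∀ {n} (p : Subset n) x → p ⊆ insert p x
⊆-insert p x = p⊆p∪q ⁅ x ⁆

∈-insert : ∀ {n} (p : Subset n) x → x ∈ insert p x
∈-insert p x = q⊆p∪q p ⁅ x ⁆ (x∈⁅x⁆ x)

∉-subtracted : ∀ {n} (p q : Subset n) {x} → x ∈ p ─ q → x ∉ q
∉-subtracted (inside ∷ p) (outside ∷ q) here ()
∉-subtracted (_ ∷ p) (_ ∷ q) (there x∈) (there x∈q) = ∉-subtracted p q x∈ x∈q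

∈-remove⁻ : ∀ {n} (p : Subset n) x {y} → y ∈ p - x → y ∈ p × y ≢ x
∈-remove⁻ p x y∈ = p─q⊆p p ⁅ x ⁆ y∈ , x∉⁅y⁆⇒x≢y (∉-subtracted p ⁅ x ⁆ y∈)

∉-remove : ∀ {n} (p : Subset n) x → x ∉ p - x
∉-remove p x x∈ = proj₂ (∈-remove⁻ p x x∈) refl

insert-remove : ∀ {n} (σ : Subset n) t → t ∈ σ → insert (σ - t) t ≡ σ
insert-remove σ t t∈ = ⊆-antisym ⊆σ σ⊆
  where
  ⊆σ : insert (σ - t) t ⊆ σ
  ⊆σ x∈ with ∈-insert⁻ (σ - t) t x∈
  ... | inj₁ x∈σ-t = proj₁ (∈-remove⁻ σ t x∈σ-t)
  ... | inj₂ refl = t∈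
  σ⊆ : σ ⊆ insert (σ - t) t
  σ⊆ {x} x∈ with x FinP.≟ t
  ... | yes refl = ∈-insert (σ - t) t
  ... | no x≢t = ⊆-insert (σ - t) t (x∈p∧x≢y⇒x∈p-y x∈ x≢t)

insert-injective : ∀ {n} {a b : Subset n} t → t ∉ a → t ∉ b → insert a t ≡ insert b t → a ≡ b
insert-injective {a = a} {b} t t∉a t∉b eq = ⊆-antisym (half t∉a eq) (half t∉b (sym eq))
  where
  half : ∀ {p q} → t ∉ p → insert p t ≡ insert q t → p ⊆ q
  half {p} {q} t∉p e {x} x∈ with ∈-insert⁻ q t (subst (x ∈_) e (⊆-insert p t x∈))
  ... | inj₁ x∈q = x∈q
  ... | inj₂ refl = ⊥-elim (t∉p x∈)

insert-comm : ∀ {n} (a : Subset n) x y → insert (insert a x) y ≡ insert (insert a y) x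
insert-comm a x y = begin
  (a ∪ ⁅ x ⁆) ∪ ⁅ y ⁆  ≡⟨ ∪-assoc a ⁅ x ⁆ ⁅ y ⁆ ⟩
  a ∪ (⁅ x ⁆ ∪ ⁅ y ⁆)  ≡⟨ cong (a ∪_) (∪-comm ⁅ x ⁆ ⁅ y ⁆) ⟩
  a ∪ (⁅ y ⁆ ∪ ⁅ x ⁆)  ≡⟨ sym (∪-assoc a ⁅ y ⁆ ⁅ x ⁆) ⟩
  (a ∪ ⁅ y ⁆) ∪ ⁅ x ⁆  ∎
  where open ≡-Reasoning

insert-mono : ∀ {n} {a b : Subset n} t → a ⊆ b → insert a t ⊆ insert b t
insert-mono {a = a} {b} t a⊆b x∈ with ∈-insert⁻ a t x∈
... | inj₁ x∈a = ⊆-insert b t (a⊆b x∈a)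
... | inj₂ refl = ∈-insert b t

⊂-witness : ∀ {n} (p q : Subset n) → p ⊆ q → p ≢ q → ∃[ x ] (x ∈ q × x ∉ p)
⊂-witness p q p⊆q p≢q with FinP.any? (λ x → (x ∈? q) ×-dec ¬? (x ∈? p))
... | yes w = w
... | no none = ⊥-elim (p≢q (⊆-antisym p⊆q q⊆p))
  where
  q⊆p : q ⊆ p
  q⊆p {x} x∈q with x ∈? p
  ... | yes x∈p = x∈p
  ... | no x∉p = ⊥-elim (none (x , x∈q , x∉p))

select : ∀ {n} {P : Fin n → Set} → Decidable P → Subset n
select P? = tabulate (λ x → does (P? x))

∈-select⁺ : ∀ {n} {P : Fin n → Set} (P? : Decidable P) {x} → P x → x ∈ select P?
∈-select⁺ P? {x} px = lookup⇒[]= x _ (trans (lookup∘tabulate _ x) (dec-true (P? x) px))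

∈-select⁻ : ∀ {n} {P : Fin n → Set} (P? : Decidable P) {x} → x ∈ select P? → P x
∈-select⁻ P? {x} x∈ = accept (P? x) (trans (sym (lookup∘tabulate _ x)) ([]=⇒lookup x∈))
  where
  accept : ∀ {A : Set} (a? : Dec A) → does a? ≡ true → A
  accept (yes a) _ = a

∣p∣≤1+∣p-x∣ : ∀ {n} (p : Subset n) x → ∣ p ∣ ≤ suc ∣ p - x ∣
∣p∣≤1+∣p-x∣ (inside ∷ p) zero = ℕP.≤-reflexive (cong (λ z → suc ∣ z ∣) (sym (p─⊥≡p p)))
∣p∣≤1+∣p-x∣ (outside ∷ p) zero = ℕP.m≤n⇒m≤1+n (ℕP.≤-reflexive (cong ∣_∣ (sym (p─⊥≡p p))))
∣p∣≤1+∣p-x∣ (inside ∷ p) (suc x) = s≤s (∣p∣≤1+∣p-x∣ p x)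
∣p∣≤1+∣p-x∣ (outside ∷ p) (suc x) = ∣p∣≤1+∣p-x∣ p x

∣∣≤length : ∀ {n} (es : List ℕ) (v : Subset n) → (∀ x → x ∈ v → toℕ x ∈ₗ es) → ∣ v ∣ ≤ length es
∣∣≤length {n} [] v vals = ℕP.≤-reflexive (trans (cong ∣_∣ (Empty-unique none)) (∣⊥∣≡0 n))
  where
  none : ¬ Nonempty v
  none (x , x∈) with vals x x∈
  ... | ()
∣∣≤length {n} (e ∷ es) v vals with e ℕP.<? n
... | yes e<n = ℕP.≤-trans (∣p∣≤1+∣p-x∣ v y) (s≤s (∣∣≤length es (v - y) vals′))
  where
  y = fromℕ< e<n
  vals′ : ∀ x → x ∈ v - y → toℕ x ∈ₗ es
  vals′ x x∈ with ∈-remove⁻ v y x∈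
  ... | x∈v , x≢y with vals x x∈v
  ... | there x∈es = x∈es
  ... | here refl = ⊥-elim (x≢y (FinP.toℕ-injective (sym (FinP.toℕ-fromℕ< e<n))))
... | no e≮n = ℕP.m≤n⇒m≤1+n (∣∣≤length es v vals′)
  where
  vals′ : ∀ x → x ∈ v → toℕ x ∈ₗ es
  vals′ x x∈ with vals x x∈
  ... | there x∈es = x∈es
  ... | here refl = ⊥-elim (e≮n (FinP.toℕ<n x))

next-step : ∀ {m} (t : Fin (suc m)) → suc (toℕ t) < suc m → toℕ (next t) ≡ suc (toℕ t)
next-step {m} t lt = trans (FinP.toℕ-fromℕ< _) (m<n⇒m%n≡m lt)

next-wrap : ∀ {m} (t : Fin (suc m)) → suc (toℕ t) ≡ suc m → toℕ (next t) ≡ 0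
next-wrap {m} t eq = trans (FinP.toℕ-fromℕ< _) (trans (cong (_% suc m) eq) (n%n≡0 (suc m)))

next-cases : ∀ {m} (t : Fin (suc m)) → toℕ (next t) ≡ suc (toℕ t) ⊎ toℕ (next t) ≡ 0
next-cases {m} t with suc (toℕ t) ℕP.<? suc m
... | yes lt = inj₁ (next-step t lt)
... | no ≮ = inj₂ (next-wrap t (ℕP.≤-antisym (FinP.toℕ<n t) (ℕP.≮⇒≥ ≮)))

next-last : ∀ m → next (fromℕ m) ≡ zero
next-last m = FinP.toℕ-injective (next-wrap (fromℕ m) (cong suc (FinP.toℕ-fromℕ m)))

previous : ∀ {m} (j : Fin (suc m)) → ∃[ i ] (next i ≡ j)
previous {m} zero = fromℕ m , next-last m
previous {suc m} (suc j) = inject₁ j , FinP.toℕ-injective (trans (next-step (inject₁ j) lt) (cong suc (FinP.toℕ-inject₁ j)))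
  where
  lt : suc (toℕ (inject₁ j)) < suc (suc m)
  lt = s≤s (subst (_< suc m) (sym (FinP.toℕ-inject₁ j)) (FinP.toℕ<n j))

next-≢ : ∀ {m} (i : Fin (suc (suc m))) → next i ≢ i
next-≢ {m} i eq with next-cases i
... | inj₁ e = ℕP.1+n≢n (sym (trans (sym (cong toℕ eq)) e))
... | inj₂ e with i
...   | zero = ℕP.1+n≢0 (trans (sym (next-step {suc m} zero (s≤s (s≤s z≤n)))) e)
...   | suc i′ = ℕP.1+n≢0 (trans (cong toℕ (sym eq)) e)

module AroundCycle {a r} {A : Set a} (R : A → A → Set r)
  (R-refl : ∀ {x} → R x x) (R-trans : ∀ {x y z} → R x y → R y z → R x z)
  {m : ℕ} (f : Fin (suc m) → A) (step : ∀ i → R (f i) (f (next i))) where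

  private
    forward : ∀ d (x y : Fin (suc m)) → toℕ y ≡ toℕ x + d → R (f x) (f y)
    forward zero x y eq rewrite FinP.toℕ-injective (trans eq (ℕP.+-identityʳ _)) = R-refl
    forward (suc d) x y eq = R-trans (step x) (forward d (next x) y eq′)
      where
      lt : suc (toℕ x) < suc m
      lt = ℕP.≤-<-trans (ℕP.≤-trans (ℕP.m≤m+n (suc (toℕ x)) d)
             (ℕP.≤-reflexive (trans (sym (ℕP.+-suc (toℕ x) d)) (sym eq)))) (FinP.toℕ<n y)
      eq′ : toℕ y ≡ toℕ (next x) + d
      eq′ = trans eq (trans (ℕP.+-suc (toℕ x) d) (cong (_+ d) (sym (next-step x lt))))

    upward : ∀ (x y : Fin (suc m)) → toℕ x ≤ toℕ y → R (f x) (f y)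
    upward x y le = forward (toℕ y ∸ toℕ x) x y (sym (ℕP.m+[n∸m]≡n le))

  related : ∀ i j → R (f i) (f j)
  related i j = R-trans (upward i (fromℕ m) i≤m)
                 (R-trans (subst (λ z → R (f (fromℕ m)) (f z)) (next-last m) (step (fromℕ m))) (upward zero j z≤n))
    where
    i≤m : toℕ i ≤ toℕ (fromℕ m)
    i≤m = subst (toℕ i ≤_) (sym (FinP.toℕ-fromℕ m)) (ℕP.≤-pred (FinP.toℕ<n i))

allSubsets-complete : ∀ {n} (s : Subset n) → s ∈ₗ allSubsets n
allSubsets-complete [] = here refl
allSubsets-complete {suc n} (outside ∷ s) = ∈-++⁺ˡ (∈-map⁺ (outside ∷_) (allSubsets-complete s))
allSubsets-complete {suc n} (inside ∷ s) =
  ∈-++⁺ʳ (map (outside ∷_) (allSubsets n)) (∈-map⁺ (inside ∷_) (allSubsets-complete s))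

vertex-card : ∀ k (v : Vertex k) → ∣ vset k v ∣ ≡ 3
vertex-card k v = proj₂ (∈-filter⁻ (λ s → ∣ s ∣ ℕP.≟ 3) {xs = allSubsets (6 + k)} (∈-lookup v))

vertex-of : ∀ k (s : Subset (6 + k)) → ∣ s ∣ ≡ 3 → ∃[ v ] (vset k v ≡ s)
vertex-of k s card = index s∈ , sym (lookup-index s∈)
  where s∈ = ∈-filter⁺ (λ s → ∣ s ∣ ℕP.≟ 3) (allSubsets-complete s) card

module Matchings (k : ℕ) where

  Elementary : List (Pair k) → Set
  Elementary M = ∀ {p} → p ∈ₗ M → ∃[ y ] (y ∉ proj₁ p × proj₂ p ≡ insert (proj₁ p) y)

  -- A perfect acyclic matching on the subposet P all of whose pairs are elementary; the last
  -- property is what lets such matchings be lifted through the element matching below.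
  record PerfectAcyclic (P : VSet k → Set) (M : List (Pair k)) : Set where
    field
      matching   : IsMatching k P M
      acyclic    : IsAcyclic k P M
      perfect    : IsPerfect k P M
      elementary : Elementary M

  insert-covers : ∀ (P : VSet k → Set) {a b} y → P a → P b → y ∉ a → b ≡ insert a y → Covers k P a b
  insert-covers P {a} y Pa Pb y∉a refl = Pa , Pb , (⊆-insert a y , y , ∈-insert a y , y∉a) , nothing-between
    where
    nothing-between : ¬ (∃[ c ] (P c × a ⊂ c × c ⊂ insert a y))
    nothing-between (c , _ , (a⊆c , x , x∈c , x∉a) , (c⊆b , z , z∈b , z∉c))
      with ∈-insert⁻ a y (c⊆b x∈c) | ∈-insert⁻ a y z∈b
    ... | inj₁ x∈a  | _         = x∉a x∈a
    ... | inj₂ refl | inj₁ z∈a  = z∉c (a⊆c z∈a)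
    ... | inj₂ refl | inj₂ refl = z∉c x∈c

  covers-transfer : ∀ {P Q : VSet k → Set} → (∀ σ → P σ → Q σ) → (∀ σ → Q σ → P σ) →
                    ∀ {a b} → Covers k P a b → Covers k Q a b
  covers-transfer P⇒Q Q⇒P (Pa , Pb , a⊂b , between) =
    P⇒Q _ Pa , P⇒Q _ Pb , a⊂b , λ (c , Qc , a⊂c⊂b) → between (c , Q⇒P c Qc , a⊂c⊂b)

  transfer : ∀ {P Q : VSet k → Set} → (∀ σ → P σ → Q σ) → (∀ σ → Q σ → P σ) →
             ∀ {M} → PerfectAcyclic P M → PerfectAcyclic Q M
  transfer P⇒Q Q⇒P pa = record
    { matching   = (λ p∈ → covers-transfer P⇒Q Q⇒P (proj₁ matching p∈)) , proj₂ matching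
    ; acyclic    = λ j a u mem cov inj → acyclic j a u mem (λ i → covers-transfer Q⇒P P⇒Q (cov i)) inj
    ; perfect    = λ σ Qσ → perfect σ (Q⇒P σ Qσ)
    ; elementary = elementary
    }
    where open PerfectAcyclic pa

  empty-matching : ∀ {P : VSet k → Set} → (∀ σ → ¬ P σ) → PerfectAcyclic P []
  empty-matching ¬P = record
    { matching   = (λ ()) , (λ _ ())
    ; acyclic    = λ _ _ _ mem _ _ → no-member (mem zero)
    ; perfect    = λ σ Pσ → ⊥-elim (¬P σ Pσ)
    ; elementary = λ ()
    }
    where
    no-member : ∀ {A : Set} {p : A} → ¬ (p ∈ₗ [])
    no-member ()

module StableCovers (k : ℕ) where

  open Matchings k

  Point : Set
  Point = Fin (6 + k)

  Region : Set₁
  Region = Point → Set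

  _∖_ : Region → Subset (6 + k) → Region
  (W ∖ D) x = W x × x ∉ D

  Admissible : Region → Vertex k → Set
  Admissible W v = Stable k v × (∀ x → x ∈ vset k v → W x)

  Covered : VSet k → Point → Set
  Covered σ x = ∃[ v ] (v ∈ σ × x ∈ vset k v)

  record StableCover (W : Region) (σ : VSet k) : Set where
    constructor mkCover
    field
      nonempty   : Nonempty σ
      admissible : ∀ v → v ∈ σ → Admissible W v
      covering   : ∀ x → W x → Covered σ x

  stable? : ∀ v → Dec (Stable k v)
  stable? v = ¬? (FinP.any? (λ t → (t ∈? vset k v) ×-dec (next t ∈? vset k v)))

  covered? : ∀ σ x → Dec (Covered σ x)
  covered? σ x = FinP.any? (λ v → (v ∈? σ) ×-dec (x ∈? vset k v))

  stableCover? : ∀ {W} → Decidable W → Decidable (StableCover W)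
  stableCover? W? σ = map′ (λ (ne , adm , cov) → mkCover ne adm cov) (λ (mkCover ne adm cov) → ne , adm , cov)
    (nonempty? σ ×-dec FinP.all? (λ v → (v ∈? σ) →-dec admissible? v) ×-dec FinP.all? (λ x → W? x →-dec covered? σ x))
    where
    admissible? : ∀ v → Dec (Admissible _ v)
    admissible? v = stable? v ×-dec FinP.all? (λ x → (x ∈? vset k v) →-dec W? x)

  -- The element matching of the stable covers of W along a vertex t, patched with given
  -- matchings F D on the stable covers of the smaller regions W ∖ D (D ⊆ t nonempty).
  module ElementMatching (W : Region) (W? : Decidable W) (t : Vertex k)
                         (F : Subset (6 + k) → List (Pair k)) where

    lift : Pair k → Pair k
    lift q = insert (proj₁ q) t , insert (proj₂ q) t

    tFilter : Decidable (λ σ → StableCover W σ × t ∉ σ)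
    tFilter σ = stableCover? W? σ ×-dec ¬? (t ∈? σ)

    partFilter : Decidable (λ D → Nonempty D × D ⊆ vset k t)
    partFilter D = nonempty? D ×-dec (D ⊆? vset k t)

    tPairs : List (Pair k)
    tPairs = map (λ σ → σ , insert σ t) (filter tFilter (allSubsets (NV k)))

    parts : List (Subset (6 + k))
    parts = filter partFilter (allSubsets (6 + k))

    matchingOf : List (Pair k)
    matchingOf = tPairs ++ concatMap (λ D → map lift (F D)) parts

    record Lifted (p : Pair k) : Set where
      constructor mkLifted
      field
        part     : Subset (6 + k)
        pair     : Pair k
        nonempty : Nonempty part
        part⊆t   : part ⊆ vset k t
        pair∈    : pair ∈ₗ F part
        lifts    : p ≡ lift pair

    data Kind (p : Pair k) : Set where
      addT   : ∀ σ → StableCover W σ → t ∉ σ → p ≡ (σ , insert σ t) → Kind p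
      lifted : Lifted p → Kind p

    private
      kindT : ∀ {p} → p ∈ₗ tPairs → Kind p
      kindT {p} p∈ = addT σ (proj₁ (proj₂ filtered)) (proj₂ (proj₂ filtered)) p≡
        where
        found : ∃[ σ ] (σ ∈ₗ filter tFilter (allSubsets (NV k)) × p ≡ (σ , insert σ t))
        found = ∈-map⁻ (λ σ → σ , insert σ t) p∈
        σ : VSet k
        σ = proj₁ found
        p≡ : p ≡ (σ , insert σ t)
        p≡ = proj₂ (proj₂ found)
        filtered : σ ∈ₗ allSubsets (NV k) × (StableCover W σ × t ∉ σ)
        filtered = ∈-filter⁻ tFilter {xs = allSubsets (NV k)} (proj₁ (proj₂ found))

      kindL : ∀ {p} → p ∈ₗ concatMap (λ D → map lift (F D)) parts → Kind p
      kindL {p} p∈ = lifted (mkLifted D q (proj₁ (proj₂ filtered)) (proj₂ (proj₂ filtered)) (proj₁ (proj₂ inF)) (proj₂ (proj₂ inF)))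
        where
        inPart : ∃[ D ] (D ∈ₗ parts × p ∈ₗ map lift (F D))
        inPart = find (∈-concatMap⁻ (λ D → map lift (F D)) {xs = parts} p∈)
        D : Subset (6 + k)
        D = proj₁ inPart
        filtered : D ∈ₗ allSubsets (6 + k) × (Nonempty D × D ⊆ vset k t)
        filtered = ∈-filter⁻ partFilter {xs = allSubsets (6 + k)} (proj₁ (proj₂ inPart))
        inF : ∃[ q ] (q ∈ₗ F D × p ≡ lift q)
        inF = ∈-map⁻ lift (proj₂ (proj₂ inPart))
        q : Pair k
        q = proj₁ inF

    kind : ∀ {p} → p ∈ₗ matchingOf → Kind p
    kind p∈ = Sum.[ kindT , kindL ] (∈-++⁻ tPairs p∈)

    addT∈ : ∀ σ → StableCover W σ → t ∉ σ → (σ , insert σ t) ∈ₗ matchingOf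
    addT∈ σ cov t∉σ = ∈-++⁺ˡ (∈-map⁺ (λ σ → σ , insert σ t)
      (∈-filter⁺ tFilter (allSubsets-complete σ) (cov , t∉σ)))

    lifted∈ : ∀ D q → Nonempty D → D ⊆ vset k t → q ∈ₗ F D → lift q ∈ₗ matchingOf
    lifted∈ D q ne D⊆t q∈ = ∈-++⁺ʳ tPairs (∈-concatMap⁺ (λ D → map lift (F D))
      (lose (∈-filter⁺ partFilter (allSubsets-complete D) (ne , D⊆t)) (∈-map⁺ lift q∈)))

    module Correctness
      (t-admissible : Admissible W t) (beyond-t : ∃[ x ] (W x × x ∉ vset k t))
      (smaller : ∀ D → Nonempty D → D ⊆ vset k t → PerfectAcyclic (StableCover (W ∖ D)) (F D)) where

      with-t : ∀ {σ} → (∀ v → v ∈ σ → Admissible W v) → (∀ x → W x → x ∉ vset k t → Covered σ x) →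
               StableCover W (insert σ t)
      with-t {σ} adm cov = mkCover (t , ∈-insert σ t) adm′ cov′
        where
        adm′ : ∀ v → v ∈ insert σ t → Admissible W v
        adm′ v v∈ = Sum.[ adm v , (λ { refl → t-admissible }) ] (∈-insert⁻ σ t v∈)
        cov′ : ∀ x → W x → Covered (insert σ t) x
        cov′ x Wx with x ∈? vset k t
        ... | yes x∈t = t , ∈-insert σ t , x∈t
        ... | no x∉t = let (v , v∈ , x∈v) = cov x Wx x∉t in v , ⊆-insert σ t v∈ , x∈v

      add-t : ∀ {σ} → StableCover W σ → StableCover W (insert σ t)
      add-t (mkCover _ adm cov) = with-t adm (λ x Wx _ → cov x Wx)

      lift-cover : ∀ {D τ} → D ⊆ vset k t → StableCover (W ∖ D) τ → StableCover W (insert τ t)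
      lift-cover D⊆t (mkCover _ adm cov) =
        with-t (λ v v∈ → proj₁ (adm v v∈) , λ x x∈ → proj₁ (proj₂ (adm v v∈) x x∈))
               (λ x Wx x∉t → cov x (Wx , λ x∈D → x∉t (D⊆t x∈D)))

      t∉ : ∀ {D τ} → Nonempty D → D ⊆ vset k t → (∀ v → v ∈ τ → Admissible (W ∖ D) v) → t ∉ τ
      t∉ (d , d∈D) D⊆t adm t∈τ = proj₂ (proj₂ (adm t t∈τ) d (D⊆t d∈D)) d∈D

      no-cover : ∀ {D σ} → Nonempty D → D ⊆ vset k t → (∀ v → v ∈ σ → Admissible (W ∖ D) v) → ¬ StableCover W σ
      no-cover (d , d∈D) D⊆t adm (mkCover _ _ cov) with cov d (proj₂ t-admissible d (D⊆t d∈D))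
      ... | v , v∈ , d∈v = proj₂ (proj₂ (adm v v∈) d d∈v) d∈D

      removed-⊆ : ∀ {D D′ σ} → D ⊆ vset k t → (∀ v → v ∈ σ → Admissible (W ∖ D) v) →
                  (∀ x → (W ∖ D′) x → Covered σ x) → D ⊆ D′
      removed-⊆ {D′ = D′} D⊆t adm cov {d} d∈D with d ∈? D′
      ... | yes d∈D′ = d∈D′
      ... | no d∉D′ = let (v , v∈ , d∈v) = cov d (proj₂ t-admissible d (D⊆t d∈D) , d∉D′)
                      in ⊥-elim (proj₂ (proj₂ (adm v v∈) d d∈v) d∈D)

      module Smaller {D} (ne : Nonempty D) (D⊆t : D ⊆ vset k t) where
        open PerfectAcyclic (smaller D ne D⊆t) public

        lower : ∀ {q} → q ∈ₗ F D → StableCover (W ∖ D) (proj₁ q)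
        lower q∈ = proj₁ (proj₁ matching q∈)

        upper : ∀ {q} → q ∈ₗ F D → StableCover (W ∖ D) (proj₂ q)
        upper q∈ = proj₁ (proj₂ (proj₁ matching q∈))

        t∉cover : ∀ {τ} → StableCover (W ∖ D) τ → t ∉ τ
        t∉cover c = t∉ ne D⊆t (StableCover.admissible c)

      elementary-kind : ∀ {p} → Kind p → ∃[ y ] (y ∉ proj₁ p × proj₂ p ≡ insert (proj₁ p) y)
      elementary-kind (addT σ _ t∉σ refl) = t , t∉σ , refl
      elementary-kind (lifted (mkLifted D (a , b) ne D⊆t q∈ refl)) = y , y∉ , trans (cong (λ z → insert z t) b≡) (insert-comm a y t)
        where
        added = Smaller.elementary ne D⊆t q∈
        y = proj₁ added
        b≡ : b ≡ insert a y
        b≡ = proj₂ (proj₂ added)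
        y∉ : y ∉ insert a t
        y∉ y∈ = Sum.[ proj₁ (proj₂ added) ,
                      (λ y≡t → Smaller.t∉cover ne D⊆t (Smaller.upper ne D⊆t q∈) (subst (_∈ b) y≡t (subst (y ∈_) (sym b≡) (∈-insert a y)))) ]
                    (∈-insert⁻ a t y∈)

      both-covers : ∀ {p} → Kind p → StableCover W (proj₁ p) × StableCover W (proj₂ p)
      both-covers (addT σ cov _ refl) = cov , add-t cov
      both-covers (lifted (mkLifted D q ne D⊆t q∈ refl)) =
        lift-cover D⊆t (Smaller.lower ne D⊆t q∈) , lift-cover D⊆t (Smaller.upper ne D⊆t q∈)

      covers : ∀ {p} → p ∈ₗ matchingOf → Covers k (StableCover W) (proj₁ p) (proj₂ p)
      covers p∈ = insert-covers (StableCover W) (proj₁ added) (proj₁ (both-covers (kind p∈))) (proj₂ (both-covers (kind p∈)))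
                    (proj₁ (proj₂ added)) (proj₂ (proj₂ added))
        where added = elementary-kind (kind p∈)

      -- A set is in a pair of the first kind iff it
      -- is σ or σ ∪ {t} with σ a stable cover of W; the sets in lifted pairs are τ ∪ {t} with τ
      -- a stable cover of W ∖ D, and by  removed-⊆  such a set determines D and τ.
      In : VSet k → Pair k → Set
      In x p = x ≡ proj₁ p ⊎ x ≡ proj₂ p

      LiftedFrom : Subset (6 + k) → Pair k → VSet k → Set
      LiftedFrom D q x = ∃[ τ ] (StableCover (W ∖ D) τ × x ≡ insert τ t × In τ q)

      lifted-from : ∀ {D q} (ne : Nonempty D) (D⊆t : D ⊆ vset k t) → q ∈ₗ F D → ∀ x → In x (lift q) → LiftedFrom D q x
      lifted-from ne D⊆t q∈ x (inj₁ e) = _ , Smaller.lower ne D⊆t q∈ , e , inj₁ refl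
      lifted-from ne D⊆t q∈ x (inj₂ e) = _ , Smaller.upper ne D⊆t q∈ , e , inj₂ refl

      unique-tt : ∀ {x σ σ′} → t ∉ σ → t ∉ σ′ → In x (σ , insert σ t) → In x (σ′ , insert σ′ t) → σ ≡ σ′
      unique-tt t∉σ t∉σ′ (inj₁ refl) (inj₁ e) = e
      unique-tt {σ′ = σ′} t∉σ t∉σ′ (inj₁ refl) (inj₂ e) = ⊥-elim (t∉σ (subst (t ∈_) (sym e) (∈-insert σ′ t)))
      unique-tt {σ = σ} t∉σ t∉σ′ (inj₂ refl) (inj₁ e) = ⊥-elim (t∉σ′ (subst (t ∈_) e (∈-insert σ t)))
      unique-tt t∉σ t∉σ′ (inj₂ refl) (inj₂ e) = insert-injective t t∉σ t∉σ′ e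

      unique-tl : ∀ {x σ D q} → StableCover W σ → t ∉ σ → Nonempty D → D ⊆ vset k t →
                  In x (σ , insert σ t) → ¬ LiftedFrom D q x
      unique-tl cov t∉σ ne D⊆t (inj₁ refl) (τ , _ , e , _) = t∉σ (subst (t ∈_) (sym e) (∈-insert τ t))
      unique-tl {σ = σ} cov t∉σ ne D⊆t (inj₂ refl) (τ , cτ , e , _) =
        no-cover ne D⊆t (StableCover.admissible cτ)
          (subst (StableCover W) (insert-injective t t∉σ (Smaller.t∉cover ne D⊆t cτ) e) cov)

      unique-ll : ∀ {x D D′ q q′} (ne : Nonempty D) (D⊆t : D ⊆ vset k t) (ne′ : Nonempty D′) (D′⊆t : D′ ⊆ vset k t) →
                  q ∈ₗ F D → q′ ∈ₗ F D′ → LiftedFrom D q x → LiftedFrom D′ q′ x → q ≡ q′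
      unique-ll {D = D} {D′} {q} {q′} ne D⊆t ne′ D′⊆t q∈ q′∈ (τ , cτ , e , τ∈q) (τ′ , cτ′ , e′ , τ′∈q′) =
        same-part D≡D′ q′∈ τ≡τ′ τ′∈q′
        where
        τ≡τ′ : τ ≡ τ′
        τ≡τ′ = insert-injective t (Smaller.t∉cover ne D⊆t cτ) (Smaller.t∉cover ne′ D′⊆t cτ′) (trans (sym e) e′)
        D≡D′ : D ≡ D′
        D≡D′ = ⊆-antisym
          (removed-⊆ D⊆t (StableCover.admissible cτ) (StableCover.covering (subst (StableCover (W ∖ D′)) (sym τ≡τ′) cτ′)))
          (removed-⊆ D′⊆t (StableCover.admissible cτ′) (StableCover.covering (subst (StableCover (W ∖ D)) τ≡τ′ cτ)))
        same-part : ∀ {D″} → D ≡ D″ → q′ ∈ₗ F D″ → τ ≡ τ′ → In τ′ q′ → q ≡ q′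
        same-part refl q′∈D refl τ∈q′ = proj₂ (Smaller.matching ne D⊆t) τ q∈ q′∈D τ∈q τ∈q′

      unique-kind : ∀ {p p′} x → Kind p → Kind p′ → In x p → In x p′ → p ≡ p′
      unique-kind x (addT σ _ t∉σ refl) (addT σ′ _ t∉σ′ refl) x∈p x∈p′ = cong (λ σ → σ , insert σ t) (unique-tt t∉σ t∉σ′ x∈p x∈p′)
      unique-kind x (addT σ cov t∉σ refl) (lifted (mkLifted D q ne D⊆t q∈ refl)) x∈p x∈p′ =
        ⊥-elim (unique-tl cov t∉σ ne D⊆t x∈p (lifted-from ne D⊆t q∈ x x∈p′))
      unique-kind x (lifted (mkLifted D q ne D⊆t q∈ refl)) (addT σ cov t∉σ refl) x∈p x∈p′ =
        ⊥-elim (unique-tl cov t∉σ ne D⊆t x∈p′ (lifted-from ne D⊆t q∈ x x∈p))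
      unique-kind x (lifted (mkLifted D q ne D⊆t q∈ refl)) (lifted (mkLifted D′ q′ ne′ D′⊆t q′∈ refl)) x∈p x∈p′ =
        cong lift (unique-ll ne D⊆t ne′ D′⊆t q∈ q′∈ (lifted-from ne D⊆t q∈ x x∈p) (lifted-from ne′ D′⊆t q′∈ x x∈p′))

      matching : IsMatching k (StableCover W) matchingOf
      matching = covers , λ x p∈ p′∈ → unique-kind x (kind p∈) (kind p′∈)

      -- A stable cover σ without t is matched upwards, and one containing t is
      -- matched downwards when σ - t is still a stable cover.  Otherwise let D be the part of t
      -- covered by t alone: then σ - t is a stable cover of W ∖ D, so σ lies in a lifted pair.
      module Downwards (σ : VSet k) (cov : StableCover W σ) (t∈σ : t ∈ σ) (¬cov : ¬ StableCover W (σ - t)) where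
        τ : VSet k
        τ = σ - t

        uncovered? : Decidable (λ x → x ∈ vset k t × ¬ Covered τ x)
        uncovered? x = (x ∈? vset k t) ×-dec ¬? (covered? τ x)

        D : Subset (6 + k)
        D = select uncovered?

        D⊆t : D ⊆ vset k t
        D⊆t x∈D = proj₁ (∈-select⁻ uncovered? x∈D)

        keep : ∀ {v} → v ∈ σ → v ≢ t → v ∈ τ
        keep v∈ v≢t = x∈p∧x≢y⇒x∈p-y v∈ v≢t

        τ-admissible : ∀ v → v ∈ τ → Admissible W v
        τ-admissible v v∈ = StableCover.admissible cov v (proj₁ (∈-remove⁻ σ t v∈))

        τ-covers : ∀ x → W x → x ∉ vset k t → Covered τ x
        τ-covers x Wx x∉t = let (v , v∈ , x∈v) = StableCover.covering cov x Wx
                            in v , keep v∈ (λ v≡t → x∉t (subst (λ w → x ∈ vset k w) v≡t x∈v)) , x∈v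

        τ-nonempty : Nonempty τ
        τ-nonempty = let (x , Wx , x∉t) = beyond-t ; (v , v∈ , _) = τ-covers x Wx x∉t in v , v∈

        D-nonempty : Nonempty D
        D-nonempty = x , ∈-select⁺ uncovered? (in-t , ¬c)
          where
          missed : ∃[ x ] (W x × ¬ Covered τ x)
          missed = decidable-stable (FinP.any? (λ x → W? x ×-dec ¬? (covered? τ x)))
            (λ none → ¬cov (mkCover τ-nonempty τ-admissible
               (λ x Wx → decidable-stable (covered? τ x) (λ ¬c → none (x , Wx , ¬c)))))
          x = proj₁ missed
          ¬c = proj₂ (proj₂ missed)
          in-t : x ∈ vset k t
          in-t = decidable-stable (x ∈? vset k t) (λ x∉t → ¬c (τ-covers x (proj₁ (proj₂ missed)) x∉t))

        τ-cover : StableCover (W ∖ D) τ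
        τ-cover = mkCover τ-nonempty adm cov′
          where
          adm : ∀ v → v ∈ τ → Admissible (W ∖ D) v
          adm v v∈ = proj₁ (τ-admissible v v∈) ,
                     λ y y∈v → proj₂ (τ-admissible v v∈) y y∈v , λ y∈D → proj₂ (∈-select⁻ uncovered? y∈D) (v , v∈ , y∈v)
          cov′ : ∀ y → (W ∖ D) y → Covered τ y
          cov′ y (Wy , y∉D) = decidable-stable (covered? τ y)
            (λ ¬c → y∉D (∈-select⁺ uncovered? (decidable-stable (y ∈? vset k t) (λ y∉t → ¬c (τ-covers y Wy y∉t)) , ¬c)))

        matched : ∃[ p ] (p ∈ₗ matchingOf × In σ p)
        matched = lift q , lifted∈ D q D-nonempty D⊆t q∈ ,
                  Sum.map (λ e → trans σ≡ (cong (λ z → insert z t) e)) (λ e → trans σ≡ (cong (λ z → insert z t) e)) τ∈q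
          where
          found = Smaller.perfect D-nonempty D⊆t τ τ-cover
          q = proj₁ found
          q∈ = proj₁ (proj₂ found)
          τ∈q = proj₂ (proj₂ found)
          σ≡ : σ ≡ insert τ t
          σ≡ = sym (insert-remove σ t t∈σ)

      perfect-with-t : ∀ σ → StableCover W σ → t ∈ σ → Dec (StableCover W (σ - t)) → ∃[ p ] (p ∈ₗ matchingOf × In σ p)
      perfect-with-t σ cov t∈σ (yes cov′) = _ , addT∈ (σ - t) cov′ (∉-remove σ t) , inj₂ (sym (insert-remove σ t t∈σ))
      perfect-with-t σ cov t∈σ (no ¬cov) = Downwards.matched σ cov t∈σ ¬cov

      perfect-cases : ∀ σ → StableCover W σ → Dec (t ∈ σ) → ∃[ p ] (p ∈ₗ matchingOf × In σ p)
      perfect-cases σ cov (no t∉σ) = _ , addT∈ σ cov t∉σ , inj₁ refl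
      perfect-cases σ cov (yes t∈σ) = perfect-with-t σ cov t∈σ (stableCover? W? (σ - t))

      perfect : IsPerfect k (StableCover W) matchingOf
      perfect σ cov = perfect-cases σ cov (t ∈? σ)

      unlift-covers : ∀ {D} (ne : Nonempty D) (D⊆t : D ⊆ vset k t) {A U} →
                      StableCover (W ∖ D) A → StableCover (W ∖ D) U →
                      Covers k (StableCover W) (insert A t) (insert U t) → Covers k (StableCover (W ∖ D)) A U
      unlift-covers {D} ne D⊆t {A} {U} cA cU (_ , _ , (A⊆U , z , z∈U , z∉A) , between) =
        cA , cU , (A⊆U′ , z , z∈U′ , λ z∈A → z∉A (⊆-insert A t z∈A)) , between′
        where
        t∉A = Smaller.t∉cover ne D⊆t cA
        t∉U = Smaller.t∉cover ne D⊆t cU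
        A⊆U′ : A ⊆ U
        A⊆U′ {x} x∈ = Sum.[ (λ x∈U → x∈U) , (λ x≡t → ⊥-elim (t∉A (subst (_∈ A) x≡t x∈))) ]
                        (∈-insert⁻ U t (A⊆U (⊆-insert A t x∈)))
        z∈U′ : z ∈ U
        z∈U′ = Sum.[ (λ z∈U → z∈U) , (λ z≡t → ⊥-elim (z∉A (subst (_∈ insert A t) (sym z≡t) (∈-insert A t)))) ]
                 (∈-insert⁻ U t z∈U)
        between′ : ¬ (∃[ c ] (StableCover (W ∖ D) c × A ⊂ c × c ⊂ U))
        between′ (c , cc , (A⊆c , x , x∈c , x∉A) , (c⊆U , y , y∈U , y∉c)) =
          between (insert c t , lift-cover D⊆t cc ,
                   (insert-mono t A⊆c , x , ⊆-insert c t x∈c , x∉) , (insert-mono t c⊆U , y , ⊆-insert U t y∈U , y∉))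
          where
          x∉ : x ∉ insert A t
          x∉ x∈ = Sum.[ x∉A , (λ x≡t → Smaller.t∉cover ne D⊆t cc (subst (_∈ c) x≡t x∈c)) ] (∈-insert⁻ A t x∈)
          y∉ : y ∉ insert c t
          y∉ y∈ = Sum.[ y∉c , (λ y≡t → t∉U (subst (_∈ U) y≡t y∈U)) ] (∈-insert⁻ c t y∈)

      -- Along a cycle  a i ≺ u i ≻ a (next i)  every a i contains t: for a pair of
      -- the first kind, a (next i) ⊆ u i = a i ∪ {t} without t would give a (next i) ⊂ a i ⊂ u i;
      -- for a lifted pair, a (next i) would be a stable cover of W avoiding D.  So every pair is
      -- lifted, the removed parts grow around the cycle and are therefore all equal, and removing
      -- t yields a cycle of one matching F D, which is impossible.
      module Cycle (j : ℕ) (a u : Fin (suc (suc j)) → VSet k) (mem : ∀ i → (a i , u i) ∈ₗ matchingOf)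
                   (cov : ∀ i → Covers k (StableCover W) (a (next i)) (u i))
                   (inj : ∀ i i′ → a i ≡ a i′ → i ≡ i′) where

        next⊆u : ∀ i → a (next i) ⊆ u i
        next⊆u i = proj₁ (proj₁ (proj₂ (proj₂ (cov i))))

        t∈next : ∀ i → t ∈ a (next i)
        t∈next i = decidable-stable (t ∈? a (next i)) (t-missing (kind (mem i)))
          where
          t-missing : Kind (a i , u i) → ¬ t ∉ a (next i)
          t-missing (addT σ _ _ e) t∉ = proj₂ (proj₂ (proj₂ (cov i))) (a i , proj₁ own , (next⊆a , strict) , proj₁ (proj₂ (proj₂ own)))
            where
            own = covers (mem i)
            next⊆a : a (next i) ⊆ a i
            next⊆a {x} x∈ = Sum.[ (λ x∈σ → subst (x ∈_) (sym (cong proj₁ e)) x∈σ) , (λ x≡t → ⊥-elim (t∉ (subst (_∈ a (next i)) x≡t x∈))) ]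
                              (∈-insert⁻ σ t (subst (x ∈_) (cong proj₂ e) (next⊆u i x∈)))
            strict = ⊂-witness (a (next i)) (a i) next⊆a (λ eq → next-≢ i (inj (next i) i eq))
          t-missing (lifted (mkLifted D q ne D⊆t q∈ e)) t∉ = no-cover ne D⊆t adm (proj₁ (cov i))
            where
            adm : ∀ v → v ∈ a (next i) → Admissible (W ∖ D) v
            adm v v∈ = Sum.[ StableCover.admissible (Smaller.upper ne D⊆t q∈) v , (λ v≡t → ⊥-elim (t∉ (subst (_∈ a (next i)) v≡t v∈))) ]
                         (∈-insert⁻ (proj₂ q) t (subst (v ∈_) (cong proj₂ e) (next⊆u i v∈)))

        t∈a : ∀ i → t ∈ a i
        t∈a i = subst (λ z → t ∈ a z) (proj₂ (previous i)) (t∈next (proj₁ (previous i)))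

        abstract
          lifted-at : ∀ i → Lifted (a i , u i)
          lifted-at i = only-lifted (kind (mem i))
            where
            only-lifted : Kind (a i , u i) → Lifted (a i , u i)
            only-lifted (addT σ _ t∉σ e) = ⊥-elim (t∉σ (subst (t ∈_) (cong proj₁ e) (t∈a i)))
            only-lifted (lifted l) = l

        D : Fin (suc (suc j)) → Subset (6 + k)
        D i = Lifted.part (lifted-at i)

        a′ u′ : Fin (suc (suc j)) → VSet k
        a′ i = proj₁ (Lifted.pair (lifted-at i))
        u′ i = proj₂ (Lifted.pair (lifted-at i))

        a≡ : ∀ i → a i ≡ insert (a′ i) t
        a≡ i = cong proj₁ (Lifted.lifts (lifted-at i))

        u≡ : ∀ i → u i ≡ insert (u′ i) t
        u≡ i = cong proj₂ (Lifted.lifts (lifted-at i))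

        module At (i : Fin (suc (suc j))) = Smaller (Lifted.nonempty (lifted-at i)) (Lifted.part⊆t (lifted-at i))

        a′-cover : ∀ i → StableCover (W ∖ D i) (a′ i)
        a′-cover i = At.lower i (Lifted.pair∈ (lifted-at i))

        u′-cover : ∀ i → StableCover (W ∖ D i) (u′ i)
        u′-cover i = At.upper i (Lifted.pair∈ (lifted-at i))

        -- the vertices of a′ (next i) lie in u′ i, so they avoid D i, which forces D i ⊆ D (next i)
        D-grows : ∀ i → D i ⊆ D (next i)
        D-grows i = removed-⊆ (Lifted.part⊆t (lifted-at i)) adm (StableCover.covering (a′-cover (next i)))
          where
          adm : ∀ v → v ∈ a′ (next i) → Admissible (W ∖ D i) v
          adm v v∈ = Sum.[ StableCover.admissible (u′-cover i) v ,
                           (λ v≡t → ⊥-elim (At.t∉cover (next i) (a′-cover (next i)) (subst (_∈ a′ (next i)) v≡t v∈))) ]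
                       (∈-insert⁻ (u′ i) t (subst (v ∈_) (u≡ i) (next⊆u i (subst (v ∈_) (sym (a≡ (next i))) (⊆-insert (a′ (next i)) t v∈)))))

        D-constant : ∀ i → D i ≡ D zero
        D-constant i = ⊆-antisym (related i zero) (related zero i)
          where open AroundCycle _⊆_ ⊆-refl ⊆-trans D D-grows

        module Zero = At zero

        mem′ : ∀ i → (a′ i , u′ i) ∈ₗ F (D zero)
        mem′ i = subst (λ E → Lifted.pair (lifted-at i) ∈ₗ F E) (D-constant i) (Lifted.pair∈ (lifted-at i))

        cov′ : ∀ i → Covers k (StableCover (W ∖ D zero)) (a′ (next i)) (u′ i)
        cov′ i = unlift-covers (Lifted.nonempty (lifted-at zero)) (Lifted.part⊆t (lifted-at zero))
                   (subst (λ E → StableCover (W ∖ E) (a′ (next i))) (D-constant (next i)) (a′-cover (next i)))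
                   (subst (λ E → StableCover (W ∖ E) (u′ i)) (D-constant i) (u′-cover i))
                   (subst₂ (Covers k (StableCover W)) (a≡ (next i)) (u≡ i) (cov i))

        inj′ : ∀ i i′ → a′ i ≡ a′ i′ → i ≡ i′
        inj′ i i′ e = inj i i′ (trans (a≡ i) (trans (cong (λ z → insert z t) e) (sym (a≡ i′))))

        impossible : ⊥
        impossible = Zero.acyclic j a′ u′ mem′ cov′ inj′

      element-matching : PerfectAcyclic (StableCover W) matchingOf
      element-matching = record
        { matching   = matching
        ; acyclic    = Cycle.impossible
        ; perfect    = perfect
        ; elementary = λ p∈ → elementary-kind (kind p∈)
        }

  Matchable : Region → Set
  Matchable W = ∃[ M ] PerfectAcyclic (StableCover W) M

  cover-≐ : ∀ {W W′ : Region} → (∀ x → W x ⇔ W′ x) → ∀ σ → StableCover W σ → StableCover W′ σ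
  cover-≐ same σ (mkCover ne adm cov) =
    mkCover ne (λ v v∈ → proj₁ (adm v v∈) , λ x x∈ → to (same x) (proj₂ (adm v v∈) x x∈)) (λ x W′x → cov x (from (same x) W′x))

  matchable-≐ : ∀ {W W′ : Region} → (∀ x → W x ⇔ W′ x) → Matchable W → Matchable W′
  matchable-≐ same (M , pa) = M , transfer (cover-≐ same) (cover-≐ (λ x → ⇔-sym (same x))) pa

  element-step : ∀ {W} (W? : Decidable W) t → Admissible W t → ∃[ x ] (W x × x ∉ vset k t) →
                 (∀ D → Nonempty D → D ⊆ vset k t → Matchable (W ∖ D)) → Matchable W
  element-step {W} W? t admissible beyond smaller =
    ElementMatching.matchingOf W W? t F ,
    ElementMatching.Correctness.element-matching W W? t F admissible beyond
      (λ D ne D⊆t → chosen-good D (nonempty? D ×-dec (D ⊆? vset k t)) ne D⊆t)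
    where
    chosen : ∀ D → Dec (Nonempty D × D ⊆ vset k t) → List (Pair k)
    chosen D (yes (ne , D⊆t)) = proj₁ (smaller D ne D⊆t)
    chosen D (no _) = []
    F : Subset (6 + k) → List (Pair k)
    F D = chosen D (nonempty? D ×-dec (D ⊆? vset k t))
    chosen-good : ∀ D (part? : Dec (Nonempty D × D ⊆ vset k t)) → Nonempty D → D ⊆ vset k t →
                  PerfectAcyclic (StableCover (W ∖ D)) (chosen D part?)
    chosen-good D (yes (ne , D⊆t)) _ _ = proj₂ (smaller D ne D⊆t)
    chosen-good D (no ¬part) ne D⊆t = ⊥-elim (¬part (ne , D⊆t))

  size : ∀ {W : Region} → Decidable W → ℕ
  size W? = ∣ select W? ∣

  size-< : ∀ {W W′ : Region} (W? : Decidable W) (W′? : Decidable W′) → (∀ x → W′ x → W x) →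
           ∀ d → W d → ¬ W′ d → size W′? < size W?
  size-< W? W′? W′⊆W d Wd ¬W′d = p⊂q⇒∣p∣<∣q∣
    ((λ x∈ → ∈-select⁺ W? (W′⊆W _ (∈-select⁻ W′? x∈))) , d , ∈-select⁺ W? Wd , λ d∈ → ¬W′d (∈-select⁻ W′? d∈))

_∈[_,_] : ℕ → ℕ → ℕ → Set
m ∈[ a , b ] = a ≤ m × m ≤ b

_∈[_,_]? : ∀ m a b → Dec (m ∈[ a , b ])
m ∈[ a , b ]? = (a ℕP.≤? m) ×-dec (m ℕP.≤? b)

raise-start : ∀ {D : ℕ → Set} a → Dec (D a) →
              ∃[ a′ ] (a ≤ a′ × ∀ m → (a′ ≤ m ⇔ (a ≤ m × (D a → m ≢ a))))
raise-start a (no ¬Da) = a , ℕP.≤-refl , λ m → mk⇔ (λ a≤m → a≤m , λ Da → ⊥-elim (¬Da Da)) proj₁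
raise-start a (yes Da) = suc a , ℕP.n≤1+n a ,
  λ m → mk⇔ (λ a<m → ℕP.<⇒≤ a<m , λ _ m≡a → ℕP.<⇒≢ a<m (sym m≡a)) (λ (a≤m , m≢a) → ℕP.≤∧≢⇒< a≤m (λ a≡m → m≢a Da (sym a≡m)))

lower-end : ∀ {D : ℕ → Set} → ¬ D 0 → ∀ b → Dec (D b) →
            ∃[ b′ ] (b′ ≤ b × ∀ m → (m ≤ b′ ⇔ (m ≤ b × (D b → m ≢ b))))
lower-end ¬D0 b (no ¬Db) = b , ℕP.≤-refl , λ m → mk⇔ (λ m≤b → m≤b , λ Db → ⊥-elim (¬Db Db)) proj₁
lower-end ¬D0 zero (yes D0) = ⊥-elim (¬D0 D0)
lower-end ¬D0 (suc b) (yes Db) = b , ℕP.n≤1+n b ,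
  λ m → mk⇔ (λ m≤b → ℕP.m≤n⇒m≤1+n m≤b , λ _ → ℕP.<⇒≢ (s≤s m≤b)) (λ (m≤1+b , m≢) → ℕP.≤-pred (ℕP.≤∧≢⇒< m≤1+b (m≢ Db)))

record Trimmed (D : ℕ → Set) (a b : ℕ) : Set where
  constructor trimmed
  field
    lo hi : ℕ
    a≤lo  : a ≤ lo
    hi≤b  : hi ≤ b
    same  : ∀ m → m ∈[ lo , hi ] ⇔ (m ∈[ a , b ] × ¬ D m)

trim : ∀ {D : ℕ → Set} → Decidable D → ¬ D 0 → ∀ a b → (∀ m → m ∈[ a , b ] → D m → m ≡ a ⊎ m ≡ b) → Trimmed D a b
trim {D} D? ¬D0 a b ends = trimmed (proj₁ left) (proj₁ right) (proj₁ (proj₂ left)) (proj₁ (proj₂ right)) (λ m → mk⇔ (shrunk m) (kept m))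
  where
  left = raise-start {D = D} a (D? a)
  right = lower-end {D = D} ¬D0 b (D? b)
  shrunk : ∀ m → m ∈[ proj₁ left , proj₁ right ] → m ∈[ a , b ] × ¬ D m
  shrunk m (lo≤m , m≤hi) = (proj₁ L , proj₁ R) , not-end
    where
    L = to (proj₂ (proj₂ left) m) lo≤m
    R = to (proj₂ (proj₂ right) m) m≤hi
    not-end : ¬ D m
    not-end Dm with ends m (proj₁ L , proj₁ R) Dm
    ... | inj₁ refl = proj₂ L Dm refl
    ... | inj₂ refl = proj₂ R Dm refl
  kept : ∀ m → m ∈[ a , b ] × ¬ D m → m ∈[ proj₁ left , proj₁ right ]
  kept m ((a≤m , m≤b) , ¬Dm) =
    from (proj₂ (proj₂ left) m) (a≤m , λ Da m≡a → ¬Dm (subst D (sym m≡a) Da)) ,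
    from (proj₂ (proj₂ right) m) (m≤b , λ Db m≡b → ¬Dm (subst D (sym m≡b) Db))

record Shape : Set where
  constructor shape
  field a₁ b₁ a₂ b₂ : ℕ

_∈ₛ_ : ℕ → Shape → Set
m ∈ₛ shape a₁ b₁ a₂ b₂ = m ∈[ a₁ , b₁ ] ⊎ m ∈[ a₂ , b₂ ]

Valid : ℕ → Shape → Set
Valid n (shape a₁ b₁ a₂ b₂) = 2 ≤ a₁ × 2 + b₁ ≤ a₂ × b₁ < n × b₂ < n

_∈ₛ?_ : ∀ m s → Dec (m ∈ₛ s)
m ∈ₛ? shape a₁ b₁ a₂ b₂ = (m ∈[ a₁ , b₁ ]?) ⊎-dec (m ∈[ a₂ , b₂ ]?)

shape-bound : ∀ {n s m} → Valid n s → m ∈ₛ s → m < n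
shape-bound {s = shape a₁ b₁ a₂ b₂} (_ , _ , b₁<n , _) (inj₁ (_ , m≤b₁)) = ℕP.≤-<-trans m≤b₁ b₁<n
shape-bound {s = shape a₁ b₁ a₂ b₂} (_ , _ , _ , b₂<n) (inj₂ (_ , m≤b₂)) = ℕP.≤-<-trans m≤b₂ b₂<n

Removal : ℕ → Shape → (ℕ → Set) → Set
Removal n s D = ∃[ s′ ] (Valid n s′ × ∀ m → m ∈ₛ s′ ⇔ (m ∈ₛ s × ¬ D m))

trim-shape : ∀ {n} {D : ℕ → Set} a₁ b₁ a₂ b₂ → Valid n (shape a₁ b₁ a₂ b₂) → Decidable D → ¬ D 0 →
             (∀ m → m ∈[ a₁ , b₁ ] → D m → m ≡ a₁ ⊎ m ≡ b₁) →
             (∀ m → m ∈[ a₂ , b₂ ] → D m → m ≡ a₂ ⊎ m ≡ b₂) → Removal n (shape a₁ b₁ a₂ b₂) D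
trim-shape a₁ b₁ a₂ b₂ (2≤a₁ , gap , b₁<n , b₂<n) D? ¬D0 ends₁ ends₂ =
  shape (lo I₁) (hi I₁) (lo I₂) (hi I₂) , valid′ , λ m → mk⇔ (shrunk m) (kept m)
  where
  open Trimmed
  I₁ = trim D? ¬D0 a₁ b₁ ends₁
  I₂ = trim D? ¬D0 a₂ b₂ ends₂
  valid′ : Valid _ (shape (lo I₁) (hi I₁) (lo I₂) (hi I₂))
  valid′ = ℕP.≤-trans 2≤a₁ (a≤lo I₁) , ℕP.≤-trans (ℕP.+-monoʳ-≤ 2 (hi≤b I₁)) (ℕP.≤-trans gap (a≤lo I₂)) ,
           ℕP.≤-<-trans (hi≤b I₁) b₁<n , ℕP.≤-<-trans (hi≤b I₂) b₂<n
  shrunk : ∀ m → m ∈ₛ shape (lo I₁) (hi I₁) (lo I₂) (hi I₂) → m ∈ₛ shape a₁ b₁ a₂ b₂ × ¬ _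
  shrunk m (inj₁ r) = Product.map₁ inj₁ (to (same I₁ m) r)
  shrunk m (inj₂ r) = Product.map₁ inj₂ (to (same I₂ m) r)
  kept : ∀ m → m ∈ₛ shape a₁ b₁ a₂ b₂ × ¬ _ → m ∈ₛ shape (lo I₁) (hi I₁) (lo I₂) (hi I₂)
  kept m (inj₁ i , ¬d) = inj₁ (from (same I₁ m) (i , ¬d))
  kept m (inj₂ i , ¬d) = inj₂ (from (same I₂ m) (i , ¬d))

Tri : ℕ → ℕ → ℕ → ℕ → Set
Tri p q r m = m ≡ p ⊎ m ≡ q ⊎ m ≡ r

Spread : ℕ → ℕ → ℕ → Set
Spread p q r = 2 ≤ p × 2 + p ≤ q × 2 + q ≤ r

¬Tri0 : ∀ {p q r} → Spread p q r → ¬ Tri p q r 0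
¬Tri0 (() , _ , _) (inj₁ refl)
¬Tri0 (_ , () , _) (inj₂ (inj₁ refl))
¬Tri0 (_ , _ , ()) (inj₂ (inj₂ refl))

Tri? : ∀ p q r m → Dec (Tri p q r m)
Tri? p q r m = (m ℕP.≟ p) ⊎-dec (m ℕP.≟ q) ⊎-dec (m ℕP.≟ r)

apart : ∀ {p q r u w} → Spread p q r → Tri p q r u → Tri p q r w → u ≡ w ⊎ 2 + u ≤ w ⊎ 2 + w ≤ u
apart {p} {q} {r} (_ , p<q , q<r) = cases
  where
  p<r : 2 + p ≤ r
  p<r = ℕP.≤-trans p<q (ℕP.≤-trans (ℕP.m≤n+m q 2) q<r)
  cases : ∀ {u w} → Tri p q r u → Tri p q r w → u ≡ w ⊎ 2 + u ≤ w ⊎ 2 + w ≤ u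
  cases (inj₁ refl)         (inj₁ refl)         = inj₁ refl
  cases (inj₁ refl)         (inj₂ (inj₁ refl))  = inj₂ (inj₁ p<q)
  cases (inj₁ refl)         (inj₂ (inj₂ refl))  = inj₂ (inj₁ p<r)
  cases (inj₂ (inj₁ refl))  (inj₁ refl)         = inj₂ (inj₂ p<q)
  cases (inj₂ (inj₁ refl))  (inj₂ (inj₁ refl))  = inj₁ refl
  cases (inj₂ (inj₁ refl))  (inj₂ (inj₂ refl))  = inj₂ (inj₁ q<r)
  cases (inj₂ (inj₂ refl))  (inj₁ refl)         = inj₂ (inj₂ p<r)
  cases (inj₂ (inj₂ refl))  (inj₂ (inj₁ refl))  = inj₂ (inj₂ q<r)
  cases (inj₂ (inj₂ refl))  (inj₂ (inj₂ refl))  = inj₁ refl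

no-successor : ∀ {p q r u} → Spread p q r → Tri p q r u → ¬ Tri p q r (suc u)
no-successor spread tu tw with apart spread tu tw
... | inj₁ u≡1+u = ℕP.1+n≢n (sym u≡1+u)
... | inj₂ (inj₁ 2+u≤1+u) = ℕP.<-irrefl refl (ℕP.≤-pred 2+u≤1+u)
... | inj₂ (inj₂ 3+u≤u) = ℕP.<-irrefl refl (ℕP.≤-trans (ℕP.m≤n+m (suc _) 2) 3+u≤u)

domino-ends : ∀ {m c} → m ∈[ c , suc c ] → m ≡ c ⊎ m ≡ suc c
domino-ends {m} {c} (c≤m , m≤) with m ℕP.≟ c
... | yes m≡c = inj₁ m≡c
... | no m≢c = inj₂ (ℕP.≤-antisym m≤ (ℕP.≤∧≢⇒< c≤m (λ c≡m → m≢c (sym c≡m))))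

gap-≢ : ∀ {m b a x} → m ≤ b → 2 + b ≤ a → a ≤ x → m ≢ x
gap-≢ m≤b gap a≤x = ℕP.<⇒≢ (ℕP.≤-trans (s≤s m≤b) (ℕP.≤-trans (ℕP.n≤1+n _) (ℕP.≤-trans gap a≤x)))

record Step (n : ℕ) (s : Shape) : Set₁ where
  field
    p q r w : ℕ
    spread  : Spread p q r
    pqr⊆s  : ∀ m → Tri p q r m → m ∈ₛ s
    w∈s     : w ∈ₛ s
    w∉pqr   : ¬ Tri p q r w
    removal : ∀ {D : ℕ → Set} → Decidable D → (∀ m → D m → Tri p q r m) → Removal n s D

left-end-step : ∀ {n} a₁ b₁ a₂ b₂ → Valid n (shape a₁ b₁ a₂ b₂) → a₁ ≤ b₁ → 2 + a₂ ≤ b₂ → Step n (shape a₁ b₁ a₂ b₂)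
left-end-step a₁ b₁ a₂ b₂ v@(2≤a₁ , gap , _) a₁≤b₁ long₂ = record
  { p = a₁ ; q = a₂ ; r = b₂ ; w = suc a₂ ; spread = spread ; pqr⊆s = pqr⊆s
  ; w∈s = inj₂ (ℕP.n≤1+n a₂ , ℕP.≤-trans (ℕP.n≤1+n _) long₂) ; w∉pqr = w∉
  ; removal = λ D? D⊆ → trim-shape a₁ b₁ a₂ b₂ v D? (λ D0 → ¬Tri0 spread (D⊆ 0 D0)) (ends₁ D⊆) (ends₂ D⊆)
  }
  where
  spread : Spread a₁ a₂ b₂
  spread = 2≤a₁ , ℕP.≤-trans (ℕP.+-monoʳ-≤ 2 a₁≤b₁) gap , long₂
  a₂≤b₂ : a₂ ≤ b₂
  a₂≤b₂ = ℕP.≤-trans (ℕP.m≤n+m a₂ 2) long₂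
  pqr⊆s : ∀ m → Tri a₁ a₂ b₂ m → m ∈ₛ shape a₁ b₁ a₂ b₂
  pqr⊆s _ (inj₁ refl) = inj₁ (ℕP.≤-refl , a₁≤b₁)
  pqr⊆s _ (inj₂ (inj₁ refl)) = inj₂ (ℕP.≤-refl , a₂≤b₂)
  pqr⊆s _ (inj₂ (inj₂ refl)) = inj₂ (a₂≤b₂ , ℕP.≤-refl)
  w∉ : ¬ Tri a₁ a₂ b₂ (suc a₂)
  w∉ (inj₁ e) = gap-≢ a₁≤b₁ gap (ℕP.n≤1+n a₂) (sym e)
  w∉ (inj₂ (inj₁ e)) = ℕP.1+n≢n e
  w∉ (inj₂ (inj₂ e)) = ℕP.<⇒≢ long₂ e
  ends₁ : ∀ {D : ℕ → Set} → (∀ m → D m → Tri a₁ a₂ b₂ m) → ∀ m → m ∈[ a₁ , b₁ ] → D m → m ≡ a₁ ⊎ m ≡ b₁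
  ends₁ D⊆ m (_ , m≤b₁) Dm with D⊆ m Dm
  ... | inj₁ m≡a₁ = inj₁ m≡a₁
  ... | inj₂ (inj₁ m≡a₂) = ⊥-elim (gap-≢ m≤b₁ gap ℕP.≤-refl m≡a₂)
  ... | inj₂ (inj₂ m≡b₂) = ⊥-elim (gap-≢ m≤b₁ gap a₂≤b₂ m≡b₂)
  ends₂ : ∀ {D : ℕ → Set} → (∀ m → D m → Tri a₁ a₂ b₂ m) → ∀ m → m ∈[ a₂ , b₂ ] → D m → m ≡ a₂ ⊎ m ≡ b₂
  ends₂ D⊆ m (a₂≤m , _) Dm with D⊆ m Dm
  ... | inj₁ refl = ⊥-elim (gap-≢ a₁≤b₁ gap a₂≤m refl)
  ... | inj₂ e = e

right-end-step : ∀ {n} a₁ b₁ a₂ b₂ → Valid n (shape a₁ b₁ a₂ b₂) → 2 + a₁ ≤ b₁ → a₂ ≤ b₂ → Step n (shape a₁ b₁ a₂ b₂)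
right-end-step a₁ b₁ a₂ b₂ v@(2≤a₁ , gap , _) long₁ a₂≤b₂ = record
  { p = a₁ ; q = b₁ ; r = b₂ ; w = suc a₁ ; spread = spread ; pqr⊆s = pqr⊆s
  ; w∈s = inj₁ (ℕP.n≤1+n a₁ , ℕP.≤-trans (ℕP.n≤1+n _) long₁) ; w∉pqr = w∉
  ; removal = λ D? D⊆ → trim-shape a₁ b₁ a₂ b₂ v D? (λ D0 → ¬Tri0 spread (D⊆ 0 D0)) (ends₁ D⊆) (ends₂ D⊆)
  }
  where
  spread : Spread a₁ b₁ b₂
  spread = 2≤a₁ , long₁ , ℕP.≤-trans gap a₂≤b₂
  a₁≤b₁ : a₁ ≤ b₁
  a₁≤b₁ = ℕP.≤-trans (ℕP.m≤n+m a₁ 2) long₁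
  pqr⊆s : ∀ m → Tri a₁ b₁ b₂ m → m ∈ₛ shape a₁ b₁ a₂ b₂
  pqr⊆s _ (inj₁ refl) = inj₁ (ℕP.≤-refl , a₁≤b₁)
  pqr⊆s _ (inj₂ (inj₁ refl)) = inj₁ (a₁≤b₁ , ℕP.≤-refl)
  pqr⊆s _ (inj₂ (inj₂ refl)) = inj₂ (a₂≤b₂ , ℕP.≤-refl)
  w∉ : ¬ Tri a₁ b₁ b₂ (suc a₁)
  w∉ (inj₁ e) = ℕP.1+n≢n e
  w∉ (inj₂ (inj₁ e)) = ℕP.<⇒≢ long₁ e
  w∉ (inj₂ (inj₂ e)) = gap-≢ (ℕP.≤-trans (ℕP.n≤1+n _) long₁) gap a₂≤b₂ e
  ends₁ : ∀ {D : ℕ → Set} → (∀ m → D m → Tri a₁ b₁ b₂ m) → ∀ m → m ∈[ a₁ , b₁ ] → D m → m ≡ a₁ ⊎ m ≡ b₁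
  ends₁ D⊆ m (_ , m≤b₁) Dm with D⊆ m Dm
  ... | inj₁ m≡a₁ = inj₁ m≡a₁
  ... | inj₂ (inj₁ m≡b₁) = inj₂ m≡b₁
  ... | inj₂ (inj₂ m≡b₂) = ⊥-elim (gap-≢ m≤b₁ gap a₂≤b₂ m≡b₂)
  ends₂ : ∀ {D : ℕ → Set} → (∀ m → D m → Tri a₁ b₁ b₂ m) → ∀ m → m ∈[ a₂ , b₂ ] → D m → m ≡ a₂ ⊎ m ≡ b₂
  ends₂ D⊆ m (a₂≤m , _) Dm with D⊆ m Dm
  ... | inj₁ refl = ⊥-elim (gap-≢ a₁≤b₁ gap a₂≤m refl)
  ... | inj₂ (inj₁ refl) = ⊥-elim (gap-≢ ℕP.≤-refl gap a₂≤m refl)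
  ... | inj₂ (inj₂ m≡b₂) = inj₂ m≡b₂

-- Removing part of {a₁ , a₁ + 2 , b₁} from a shape whose second interval is empty: if the
-- interior point a₁ + 2 is removed, the first interval splits into [a₁ , a₁ + 1] ∪ [a₁ + 3 , b₁],
-- and otherwise only endpoints are removed.
removal-only-first : ∀ {n} {D : ℕ → Set} a₁ b₁ a₂ b₂ → Valid n (shape a₁ b₁ a₂ b₂) → b₂ < a₂ → 4 + a₁ ≤ b₁ →
                     Decidable D → (∀ m → D m → Tri a₁ (2 + a₁) b₁ m) → Removal n (shape a₁ b₁ a₂ b₂) D
removal-only-first {n} {D} a₁ b₁ a₂ b₂ v@(2≤a₁ , _ , b₁<n , _) empty long D? D⊆ = by-middle (D? (2 + a₁))
  where
  3+a₁≤b₁ : 3 + a₁ ≤ b₁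
  3+a₁≤b₁ = ℕP.≤-trans (ℕP.n≤1+n _) long
  ¬D0 : ¬ D 0
  ¬D0 D0 = ¬Tri0 (2≤a₁ , ℕP.≤-refl , long) (D⊆ 0 D0)
  outside₂ : ∀ {m} → ¬ m ∈[ a₂ , b₂ ]
  outside₂ (a₂≤m , m≤b₂) = ℕP.<-irrefl refl (ℕP.≤-<-trans (ℕP.≤-trans a₂≤m m≤b₂) empty)

  split : Shape
  split = shape a₁ (1 + a₁) (3 + a₁) b₁

  split-removal : Removal n split D
  split-removal = trim-shape a₁ (1 + a₁) (3 + a₁) b₁ split-valid D? ¬D0 ends₁ ends₂
    where
    split-valid : Valid n split
    split-valid = 2≤a₁ , ℕP.≤-refl , ℕP.≤-<-trans (ℕP.≤-trans (ℕP.n≤1+n _) (ℕP.≤-trans (ℕP.n≤1+n _) 3+a₁≤b₁)) b₁<n , b₁<n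
    ends₁ : ∀ m → m ∈[ a₁ , 1 + a₁ ] → D m → m ≡ a₁ ⊎ m ≡ 1 + a₁
    ends₁ m (_ , m≤) Dm with D⊆ m Dm
    ... | inj₁ m≡a₁ = inj₁ m≡a₁
    ... | inj₂ (inj₁ refl) = ⊥-elim (ℕP.<-irrefl refl m≤)
    ... | inj₂ (inj₂ refl) = ⊥-elim (ℕP.<-irrefl refl (ℕP.≤-trans (s≤s m≤) (ℕP.≤-trans (ℕP.n≤1+n _) 3+a₁≤b₁)))
    ends₂ : ∀ m → m ∈[ 3 + a₁ , b₁ ] → D m → m ≡ 3 + a₁ ⊎ m ≡ b₁
    ends₂ m (3+a₁≤m , _) Dm with D⊆ m Dm
    ... | inj₁ refl = ⊥-elim (ℕP.<-irrefl refl (ℕP.≤-trans (ℕP.m≤n+m (suc a₁) 2) 3+a₁≤m))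
    ... | inj₂ (inj₁ refl) = ⊥-elim (ℕP.<-irrefl refl 3+a₁≤m)
    ... | inj₂ (inj₂ m≡b₁) = inj₂ m≡b₁

  same-rest : D (2 + a₁) → ∀ m → (m ∈ₛ split × ¬ D m) ⇔ (m ∈ₛ shape a₁ b₁ a₂ b₂ × ¬ D m)
  same-rest D-mid m = mk⇔ into back
    where
    into : m ∈ₛ split × ¬ D m → m ∈ₛ shape a₁ b₁ a₂ b₂ × ¬ D m
    into (inj₁ (a₁≤m , m≤) , ¬Dm) = inj₁ (a₁≤m , ℕP.≤-trans m≤ (ℕP.≤-trans (ℕP.m≤n+m (suc a₁) 2) 3+a₁≤b₁)) , ¬Dm
    into (inj₂ (3+a₁≤m , m≤b₁) , ¬Dm) = inj₁ (ℕP.≤-trans (ℕP.m≤n+m a₁ 3) 3+a₁≤m , m≤b₁) , ¬Dm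
    back : m ∈ₛ shape a₁ b₁ a₂ b₂ × ¬ D m → m ∈ₛ split × ¬ D m
    back (inj₂ r , _) = ⊥-elim (outside₂ r)
    back (inj₁ (a₁≤m , m≤b₁) , ¬Dm) with m ℕP.≤? 1 + a₁
    ... | yes m≤ = inj₁ (a₁≤m , m≤) , ¬Dm
    ... | no m≰ = inj₂ (ℕP.≤∧≢⇒< (ℕP.≰⇒> m≰) (λ { refl → ¬Dm D-mid }) , m≤b₁) , ¬Dm

  by-middle : Dec (D (2 + a₁)) → Removal n (shape a₁ b₁ a₂ b₂) D
  by-middle (yes D-mid) = let (s′ , v′ , same) = split-removal in s′ , v′ , λ m → same-rest D-mid m ⇔-∘ same m
  by-middle (no ¬D-mid) = trim-shape a₁ b₁ a₂ b₂ v D? ¬D0 ends₁ (λ m r _ → ⊥-elim (outside₂ r))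
    where
    ends₁ : ∀ m → m ∈[ a₁ , b₁ ] → D m → m ≡ a₁ ⊎ m ≡ b₁
    ends₁ m _ Dm with D⊆ m Dm
    ... | inj₁ m≡a₁ = inj₁ m≡a₁
    ... | inj₂ (inj₁ refl) = ⊥-elim (¬D-mid Dm)
    ... | inj₂ (inj₂ m≡b₁) = inj₂ m≡b₁

only-first-step : ∀ {n} a₁ b₁ a₂ b₂ → Valid n (shape a₁ b₁ a₂ b₂) → b₂ < a₂ → 4 + a₁ ≤ b₁ → Step n (shape a₁ b₁ a₂ b₂)
only-first-step a₁ b₁ a₂ b₂ v@(2≤a₁ , _) empty long = record
  { p = a₁ ; q = 2 + a₁ ; r = b₁ ; w = suc a₁ ; spread = 2≤a₁ , ℕP.≤-refl , long ; pqr⊆s = pqr⊆s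
  ; w∈s = inj₁ (ℕP.n≤1+n a₁ , ℕP.≤-trans (ℕP.m≤n+m (suc a₁) 3) long) ; w∉pqr = w∉
  ; removal = removal-only-first a₁ b₁ a₂ b₂ v empty long
  }
  where
  3+a₁≤b₁ : 3 + a₁ ≤ b₁
  3+a₁≤b₁ = ℕP.≤-trans (ℕP.n≤1+n _) long
  a₁≤b₁ : a₁ ≤ b₁
  a₁≤b₁ = ℕP.≤-trans (ℕP.m≤n+m a₁ 3) 3+a₁≤b₁
  pqr⊆s : ∀ m → Tri a₁ (2 + a₁) b₁ m → m ∈ₛ shape a₁ b₁ a₂ b₂
  pqr⊆s _ (inj₁ refl) = inj₁ (ℕP.≤-refl , a₁≤b₁)
  pqr⊆s _ (inj₂ (inj₁ refl)) = inj₁ (ℕP.m≤n+m a₁ 2 , ℕP.≤-trans (ℕP.n≤1+n _) 3+a₁≤b₁)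
  pqr⊆s _ (inj₂ (inj₂ refl)) = inj₁ (a₁≤b₁ , ℕP.≤-refl)
  w∉ : ¬ Tri a₁ (2 + a₁) b₁ (suc a₁)
  w∉ (inj₁ e) = ℕP.1+n≢n e
  w∉ (inj₂ (inj₁ e)) = ℕP.1+n≢n (sym e)
  w∉ (inj₂ (inj₂ e)) = ℕP.<⇒≢ (ℕP.≤-trans (ℕP.n≤1+n (2 + a₁)) 3+a₁≤b₁) e

-- When the first interval is empty, the shape is its second interval alone, moved to the front.
star : Shape → Shape
star (shape a₁ b₁ a₂ b₂) = shape a₂ b₂ (2 + b₂) b₂

star-same : ∀ a₁ b₁ a₂ b₂ → b₁ < a₁ → ∀ m → m ∈ₛ star (shape a₁ b₁ a₂ b₂) ⇔ m ∈ₛ shape a₁ b₁ a₂ b₂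
star-same a₁ b₁ a₂ b₂ empty m = mk⇔ into back
  where
  into : m ∈ₛ star (shape a₁ b₁ a₂ b₂) → m ∈ₛ shape a₁ b₁ a₂ b₂
  into (inj₁ r) = inj₂ r
  into (inj₂ (b₂+2≤m , m≤b₂)) = ⊥-elim (gap-≢ m≤b₂ b₂+2≤m ℕP.≤-refl refl)
  back : m ∈ₛ shape a₁ b₁ a₂ b₂ → m ∈ₛ star (shape a₁ b₁ a₂ b₂)
  back (inj₁ (a₁≤m , m≤b₁)) = ⊥-elim (ℕP.<-irrefl refl (ℕP.≤-<-trans (ℕP.≤-trans a₁≤m m≤b₁) empty))
  back (inj₂ r) = inj₁ r

star-valid : ∀ {n} s → Valid n s → Valid n (star s)
star-valid (shape a₁ b₁ a₂ b₂) (2≤a₁ , gap , _ , b₂<n) =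
  ℕP.≤-trans (ℕP.m≤m+n 2 b₁) gap , ℕP.≤-refl , b₂<n , b₂<n

short : ∀ {m a b} → m ∈[ a , b ] → ¬ (2 + a ≤ b) → m ∈[ a , suc a ]
short (a≤m , m≤b) long = a≤m , ℕP.≤-trans m≤b (ℕP.≤-pred (ℕP.≰⇒> long))

medium : ∀ {m a b} → m ∈[ a , b ] → ¬ (4 + a ≤ b) → m ∈[ a , suc a ] ⊎ m ∈[ 2 + a , suc (2 + a) ]
medium {m} {a} (a≤m , m≤b) long with m ℕP.≤? suc a
... | yes m≤ = inj₁ (a≤m , m≤)
... | no m≰ = inj₂ (ℕP.≰⇒> m≰ , ℕP.≤-trans m≤b (ℕP.≤-pred (ℕP.≰⇒> long)))

InDominoes : ℕ → ℕ → ℕ → Set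
InDominoes c₁ c₂ m = m ∈[ c₁ , suc c₁ ] ⊎ m ∈[ c₂ , suc c₂ ]

step-≐ : ∀ {n s s′} → (∀ m → m ∈ₛ s′ ⇔ m ∈ₛ s) → Step n s′ → Step n s
step-≐ same st = record
  { p = p ; q = q ; r = r ; w = w ; spread = spread
  ; pqr⊆s = λ m t → to (same m) (pqr⊆s m t)
  ; w∈s = to (same w) w∈s ; w∉pqr = w∉pqr
  ; removal = λ D? D⊆ → let (s″ , v″ , rest) = removal D? D⊆
                        in s″ , v″ , λ m → mk⇔ (λ r → Product.map₁ (to (same m)) (to (rest m) r))
                                                (λ (m∈ , ¬D) → from (rest m) (from (same m) m∈ , ¬D))
  }
  where open Step st

step-or-dominoes : ∀ {n} s → Valid n s → Step n s ⊎ ∃₂ λ c₁ c₂ → ∀ m → m ∈ₛ s → InDominoes c₁ c₂ m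
step-or-dominoes (shape a₁ b₁ a₂ b₂) v with a₁ ℕP.≤? b₁ | a₂ ℕP.≤? b₂
... | yes a₁≤b₁ | yes a₂≤b₂ with 2 + a₂ ℕP.≤? b₂ | 2 + a₁ ℕP.≤? b₁
...   | yes long₂ | _ = inj₁ (left-end-step a₁ b₁ a₂ b₂ v a₁≤b₁ long₂)
...   | no _ | yes long₁ = inj₁ (right-end-step a₁ b₁ a₂ b₂ v long₁ a₂≤b₂)
...   | no short₂ | no short₁ = inj₂ (a₁ , a₂ , λ m → Sum.map (λ r → short r short₁) (λ r → short r short₂))
step-or-dominoes (shape a₁ b₁ a₂ b₂) v | yes a₁≤b₁ | no a₂≰b₂ with 4 + a₁ ℕP.≤? b₁
...   | yes long₁ = inj₁ (only-first-step a₁ b₁ a₂ b₂ v (ℕP.≰⇒> a₂≰b₂) long₁)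
...   | no medium₁ = inj₂ (a₁ , 2 + a₁ , λ m → Sum.[ (λ r → medium r medium₁) , (λ (a₂≤m , m≤b₂) → ⊥-elim (a₂≰b₂ (ℕP.≤-trans a₂≤m m≤b₂))) ])
step-or-dominoes (shape a₁ b₁ a₂ b₂) v | no a₁≰b₁ | yes a₂≤b₂ with 4 + a₂ ℕP.≤? b₂
...   | yes long₂ = inj₁ (step-≐ (star-same a₁ b₁ a₂ b₂ (ℕP.≰⇒> a₁≰b₁))
                      (only-first-step a₂ b₂ (2 + b₂) b₂ (star-valid (shape a₁ b₁ a₂ b₂) v) (ℕP.m≤n+m (suc b₂) 1) long₂))
...   | no medium₂ = inj₂ (a₂ , 2 + a₂ , λ m → Sum.[ (λ (a₁≤m , m≤b₁) → ⊥-elim (a₁≰b₁ (ℕP.≤-trans a₁≤m m≤b₁))) , (λ r → medium r medium₂) ])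
step-or-dominoes (shape a₁ b₁ a₂ b₂) v | no a₁≰b₁ | no a₂≰b₂ =
  inj₂ (0 , 0 , λ m → Sum.[ (λ (a₁≤m , m≤b₁) → ⊥-elim (a₁≰b₁ (ℕP.≤-trans a₁≤m m≤b₁))) , (λ (a₂≤m , m≤b₂) → ⊥-elim (a₂≰b₂ (ℕP.≤-trans a₂≤m m≤b₂))) ])

-- The values m = label − 1 of the labels other than 1, 2 and ℓ = 3 + j form the valid shape
-- [2 , j + 1] ∪ [j + 3 , b] pqr⊆s [b + 1].
complement-valid : ∀ j b → 3 + j ≤ b → Valid (suc b) (shape 2 (suc j) (3 + j) b)
complement-valid j b ℓ≤b = s≤s (s≤s z≤n) , ℕP.≤-refl , s≤s (ℕP.≤-trans (ℕP.n≤1+n _) (ℕP.≤-trans (ℕP.n≤1+n _) ℓ≤b)) , ℕP.≤-refl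

complement : ∀ j b m → m ≤ b → m ∈ₛ shape 2 (suc j) (3 + j) b ⇔ (¬ Tri 0 1 (2 + j) m)
complement j b m m≤b = mk⇔ avoids (back m m≤b)
  where
  avoids : m ∈ₛ shape 2 (suc j) (3 + j) b → ¬ Tri 0 1 (2 + j) m
  avoids (inj₁ (() , _)) (inj₁ refl)
  avoids (inj₁ (s≤s () , _)) (inj₂ (inj₁ refl))
  avoids (inj₁ (_ , m≤1+j)) (inj₂ (inj₂ refl)) = ℕP.<-irrefl refl m≤1+j
  avoids (inj₂ (() , _)) (inj₁ refl)
  avoids (inj₂ (s≤s () , _)) (inj₂ (inj₁ refl))
  avoids (inj₂ (3+j≤m , _)) (inj₂ (inj₂ refl)) = ℕP.<-irrefl refl 3+j≤m
  back : ∀ m → m ≤ b → ¬ Tri 0 1 (2 + j) m → m ∈ₛ shape 2 (suc j) (3 + j) b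
  back zero _ ¬T = ⊥-elim (¬T (inj₁ refl))
  back (suc zero) _ ¬T = ⊥-elim (¬T (inj₂ (inj₁ refl)))
  back m@(suc (suc _)) m≤b ¬T with m ℕP.≤? suc j
  ... | yes m≤1+j = inj₁ (s≤s (s≤s z≤n) , m≤1+j)
  ... | no m≰1+j = inj₂ (ℕP.≤∧≢⇒< (ℕP.≰⇒> m≰1+j) (λ 2+j≡m → ¬T (inj₂ (inj₂ (sym 2+j≡m)))) , m≤b)

label-values : ∀ {m l} → (suc m ≡ 1 ⊎ suc m ≡ 2 ⊎ suc m ≡ suc l) ⇔ Tri 0 1 l m
label-values = mk⇔ (Sum.map ℕP.suc-injective (Sum.map ℕP.suc-injective ℕP.suc-injective))
                   (Sum.map (cong suc) (Sum.map (cong suc) (cong suc)))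

module ShapeInduction (k : ℕ) where

  open Matchings k
  open StableCovers k

  points : Shape → Region
  points s x = toℕ x ∈ₛ s

  points? : ∀ s → Decidable (points s)
  points? s x = toℕ x ∈ₛ? s

  Values : Subset (6 + k) → ℕ → Set
  Values D m = ∃[ x ] (toℕ x ≡ m × x ∈ D)

  values? : ∀ D → Decidable (Values D)
  values? D m = FinP.any? (λ x → (toℕ x ℕP.≟ m) ×-dec (x ∈? D))

  values⁻ : ∀ {D x} → Values D (toℕ x) → x ∈ D
  values⁻ {D} (y , y≡x , y∈D) = subst (_∈ D) (FinP.toℕ-injective y≡x) y∈D

  triple : ℕ → ℕ → ℕ → Subset (6 + k)
  triple p q r = select (λ x → Tri? p q r (toℕ x))

  triple-card : ∀ {p q r} → p < q → q < r → r < 6 + k → ∣ triple p q r ∣ ≡ 3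
  triple-card {p} {q} {r} p<q q<r r<n = ℕP.≤-antisym upper lower
    where
    S = triple p q r
    q<n = ℕP.<-trans q<r r<n
    p<n = ℕP.<-trans p<q q<n
    upper : ∣ S ∣ ≤ 3
    upper = ∣∣≤length (p ∷ q ∷ r ∷ []) S λ x x∈ → listed (∈-select⁻ (λ x → Tri? p q r (toℕ x)) x∈)
      where
      listed : ∀ {m} → Tri p q r m → m ∈ₗ (p ∷ q ∷ r ∷ [])
      listed (inj₁ e) = here e
      listed (inj₂ (inj₁ e)) = there (here e)
      listed (inj₂ (inj₂ e)) = there (there (here e))
    point : ∀ {m} (m<n : m < 6 + k) → Tri p q r m → fromℕ< m<n ∈ S
    point m<n t = ∈-select⁺ (λ x → Tri? p q r (toℕ x)) (subst (Tri p q r) (sym (FinP.toℕ-fromℕ< m<n)) t)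
    distinct : ∀ {a b} (a<n : a < 6 + k) (b<n : b < 6 + k) → a < b → fromℕ< b<n ≢ fromℕ< a<n
    distinct a<n b<n a<b e = ℕP.<⇒≢ a<b (trans (sym (FinP.toℕ-fromℕ< a<n)) (trans (cong toℕ (sym e)) (FinP.toℕ-fromℕ< b<n)))
    xp = fromℕ< p<n
    xq = fromℕ< q<n
    p∈ : xp ∈ S
    p∈ = point p<n (inj₁ refl)
    q∈ : xq ∈ S - xp
    q∈ = x∈p∧x≢y⇒x∈p-y (point q<n (inj₂ (inj₁ refl))) (distinct p<n q<n p<q)
    r∈ : fromℕ< r<n ∈ S - xp - xq
    r∈ = x∈p∧x≢y⇒x∈p-y (x∈p∧x≢y⇒x∈p-y (point r<n (inj₂ (inj₂ refl))) (distinct p<n r<n (ℕP.<-trans p<q q<r)))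
           (distinct q<n r<n q<r)
    lower : 3 ≤ ∣ S ∣
    lower = ℕP.≤-trans (s≤s (ℕP.≤-trans (s≤s (ℕP.≤-trans (s≤s z≤n) (x∈p⇒∣p-x∣<∣p∣ r∈))) (x∈p⇒∣p-x∣<∣p∣ q∈)))
                       (x∈p⇒∣p-x∣<∣p∣ p∈)

  -- A spread-out triple is a stable vertex: the successor of one of its points is never another
  -- one (and it never wraps around to 0).
  triple-stable : ∀ {p q r} t → vset k t ≡ triple p q r → Spread p q r → Stable k t
  triple-stable {p} {q} {r} t t≡ spread (y , y∈ , next-y∈) =
    Sum.[ (λ step → no-successor spread (value y∈) (subst (Tri p q r) step (value next-y∈))) ,
          (λ wrap → ¬Tri0 spread (subst (Tri p q r) wrap (value next-y∈))) ]′ (next-cases y)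
    where
    value : ∀ {x} → x ∈ vset k t → Tri p q r (toℕ x)
    value x∈ = ∈-select⁻ (λ x → Tri? p q r (toℕ x)) (subst (_ ∈_) t≡ x∈)

  -- A stable vertex has at most one point in a domino [c , c + 1] ...
  one-per-domino : ∀ v → Stable k v → ∀ c → ∃[ e ] (∀ x → x ∈ vset k v → toℕ x ∈[ c , suc c ] → toℕ x ≡ e)
  one-per-domino v stable c = with-left (FinP.any? (λ x → (x ∈? vset k v) ×-dec (toℕ x ℕP.≟ c)))
    where
    Result = ∃[ e ] (∀ x → x ∈ vset k v → toℕ x ∈[ c , suc c ] → toℕ x ≡ e)
    with-right : ∀ {x₀} → x₀ ∈ vset k v → toℕ x₀ ≡ c → Dec (∃[ y ] (y ∈ vset k v × toℕ y ≡ suc c)) → Result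
    with-right _ _ (no none) = c , λ x x∈ x∈d → Sum.[ (λ e → e) , (λ e → ⊥-elim (none (x , x∈ , e))) ] (domino-ends x∈d)
    with-right {x₀} x₀∈ x₀≡c (yes (y , y∈ , y≡)) = ⊥-elim (stable (x₀ , x₀∈ , subst (_∈ vset k v) (sym next≡y) y∈))
      where
      next≡y : next x₀ ≡ y
      next≡y = FinP.toℕ-injective (trans (next-step x₀ (subst (_< 6 + k) (trans y≡ (cong suc (sym x₀≡c))) (FinP.toℕ<n y)))
                                         (trans (cong suc x₀≡c) (sym y≡)))
    with-left : Dec (∃[ x ] (x ∈ vset k v × toℕ x ≡ c)) → Result
    with-left (no none) = suc c , λ x x∈ x∈d → Sum.[ (λ e → ⊥-elim (none (x , x∈ , e))) , (λ e → e) ] (domino-ends x∈d)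
    with-left (yes (x₀ , x₀∈ , x₀≡c)) = with-right x₀∈ x₀≡c (FinP.any? (λ y → (y ∈? vset k v) ×-dec (toℕ y ℕP.≟ suc c)))

  -- ... so a shape inside two dominoes contains no stable vertex and has no stable covers.
  no-cover-in-dominoes : ∀ {s c₁ c₂} → (∀ m → m ∈ₛ s → InDominoes c₁ c₂ m) → ∀ σ → ¬ StableCover (points s) σ
  no-cover-in-dominoes {s} {c₁} {c₂} dom σ (mkCover (v , v∈) adm _) = ℕP.<-irrefl (vertex-card k v) (s≤s at-most-two)
    where
    stable = proj₁ (adm v v∈)
    first = one-per-domino v stable c₁
    second = one-per-domino v stable c₂
    at-most-two : ∣ vset k v ∣ ≤ 2
    at-most-two = ∣∣≤length (proj₁ first ∷ proj₁ second ∷ []) (vset k v) λ x x∈ →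
      Sum.[ (λ x∈d → here (proj₂ first x x∈ x∈d)) , (λ x∈d → there (here (proj₂ second x x∈ x∈d))) ]′
        (dom (toℕ x) (proj₂ (adm v v∈) x x∈))

  -- The inductive step: the triple of a step is a stable vertex t inside the shape, the point w
  -- shows that the shape is not t, and each removal of a part of t is a smaller valid shape.
  Smaller : Shape → Set
  Smaller s = ∀ s′ → Valid (6 + k) s′ → size (points? s′) < size (points? s) → Matchable (points s′)

  step-matchable : ∀ s → Valid (6 + k) s → Step (6 + k) s → Smaller s → Matchable (points s)
  step-matchable s valid st smaller = element-step (points? s) t admissible beyond removed
    where
    open Step st
    gap-< : ∀ {a b} → 2 + a ≤ b → a < b
    gap-< = ℕP.≤-trans (ℕP.n≤1+n _)
    found : ∃[ t ] (vset k t ≡ triple p q r)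
    found = vertex-of k (triple p q r) (triple-card (gap-< (proj₁ (proj₂ spread))) (gap-< (proj₂ (proj₂ spread)))
                                          (shape-bound valid (pqr⊆s r (inj₂ (inj₂ refl)))))
    t = proj₁ found
    t-values : ∀ {x} → x ∈ vset k t → Tri p q r (toℕ x)
    t-values x∈ = ∈-select⁻ (λ x → Tri? p q r (toℕ x)) (subst (_ ∈_) (proj₂ found) x∈)
    admissible : Admissible (points s) t
    admissible = triple-stable t (proj₂ found) spread , λ x x∈ → pqr⊆s _ (t-values x∈)
    w<n = shape-bound valid w∈s
    beyond : ∃[ x ] (points s x × x ∉ vset k t)
    beyond = fromℕ< w<n , subst (_∈ₛ s) (sym (FinP.toℕ-fromℕ< w<n)) w∈s ,
             λ x∈ → w∉pqr (subst (Tri p q r) (FinP.toℕ-fromℕ< w<n) (t-values x∈))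
    removed : ∀ D → Nonempty D → D ⊆ vset k t → Matchable (points s ∖ D)
    removed D (d , d∈D) D⊆t = matchable-≐ same (smaller s′ valid′ shrinks)
      where
      rm = removal (values? D) (λ m (x , x≡m , x∈D) → subst (Tri p q r) x≡m (t-values (D⊆t x∈D)))
      s′ = proj₁ rm
      valid′ = proj₁ (proj₂ rm)
      same : ∀ x → points s′ x ⇔ (points s ∖ D) x
      same x = mk⇔ (λ x∈s′ → Product.map₂ (λ ¬v x∈D → ¬v (x , refl , x∈D)) (to (proj₂ (proj₂ rm) (toℕ x)) x∈s′))
                   (λ (x∈s , x∉D) → from (proj₂ (proj₂ rm) (toℕ x)) (x∈s , λ v → x∉D (values⁻ v)))
      shrinks : size (points? s′) < size (points? s)
      shrinks = size-< (points? s) (points? s′) (λ x x∈ → proj₁ (to (same x) x∈)) d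
                  (pqr⊆s _ (t-values (D⊆t d∈D))) (λ d∈s′ → proj₂ (to (same d) d∈s′) d∈D)

  matchable : ∀ f s → Valid (6 + k) s → size (points? s) < f → Matchable (points s)
  matchable zero s _ ()
  matchable (suc f) s valid size<f =
    Sum.[ (λ st → step-matchable s valid st λ s′ valid′ lt → matchable f s′ valid′ (ℕP.<-≤-trans lt (ℕP.≤-pred size<f))) ,
          (λ (_ , _ , dom) → [] , empty-matching (no-cover-in-dominoes dom)) ]′
      (step-or-dominoes s valid)

-- For ℓ = j + 3, the elements of A_k^{1,ℓ} are exactly the stable covers of the region W₀ of
-- points whose label is not 1, 2 or ℓ: the common neighbour of such a σ can only be the
-- unstable vertex {1 , 2 , ℓ}, so all vertices of σ must be stable.
module Identification (k j : ℕ) (ℓ≤ : 3 + j ≤ 5 + k) where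

  open Matchings k
  open StableCovers k
  open ShapeInduction k

  W₀ : Shape
  W₀ = shape 2 (suc j) (3 + j) (5 + k)

  Special : Point → Set
  Special x = Tri 0 1 (2 + j) (toℕ x)

  W₀-nonspecial : ∀ x → points W₀ x ⇔ (¬ Special x)
  W₀-nonspecial x = complement j (5 + k) (toℕ x) (ℕP.≤-pred (FinP.toℕ<n x))

  forced : ∀ v x e₁ e₂ → (∀ y → y ∈ vset k v → toℕ y ≡ toℕ x ⊎ toℕ y ∈ₗ (e₁ ∷ e₂ ∷ [])) → x ∈ vset k v
  forced v x e₁ e₂ values = decidable-stable (x ∈? vset k v) λ x∉v →
    ℕP.<-irrefl (vertex-card k v) (s≤s (∣∣≤length (e₁ ∷ e₂ ∷ []) (vset k v) λ y y∈ →
      Sum.[ (λ y≡x → ⊥-elim (x∉v (subst (_∈ vset k v) (FinP.toℕ-injective y≡x) y∈))) , (λ y∈es → y∈es) ]′ (values y y∈)))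

  -- A vertex of special points contains the points labelled 1 and 2, so it is not stable.
  special-unstable : ∀ w → (∀ y → y ∈ vset k w → Special y) → ¬ Stable k w
  special-unstable w special stable = stable (zero , label-1 , subst (_∈ vset k w) (sym next-0) label-2)
    where
    label-1 : zero ∈ vset k w
    label-1 = forced w zero 1 (2 + j) λ y y∈ → Sum.map₂ (Sum.[ here , (λ e → there (here e)) ]′) (special y y∈)
    label-2 : suc zero ∈ vset k w
    label-2 = forced w (suc zero) 0 (2 + j) λ y y∈ →
      Sum.[ (λ e → inj₂ (here e)) , Sum.[ inj₁ , (λ e → inj₂ (there (here e))) ]′ ]′ (special y y∈)
    next-0 : next {5 + k} zero ≡ suc zero
    next-0 = FinP.toℕ-injective (next-step {5 + k} zero (s≤s (s≤s z≤n)))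

  C-special : ∀ σ → InA k (3 + j) σ → ∀ x → InC k x σ ⇔ Special x
  C-special σ (_ , C≡) x = label-values ⇔-∘ C≡ x

  to-cover : ∀ σ → InA k (3 + j) σ → StableCover (points W₀) σ
  to-cover σ inA@((ne , w , adj) , _) = mkCover ne admissible covering
    where
    w-special : ∀ y → y ∈ vset k w → Special y
    w-special y y∈w = to (C-special σ inA y) λ (v , v∈ , y∈v) → proj₁ (adj v v∈) y y∈v y∈w
    admissible : ∀ v → v ∈ σ → Admissible (points W₀) v
    admissible v v∈ = Sum.[ (λ stable → stable) , (λ stable → ⊥-elim (special-unstable w w-special stable)) ]′ (proj₂ (adj v v∈)) ,
                      λ x x∈v → from (W₀-nonspecial x) λ special → from (C-special σ inA x) special (v , v∈ , x∈v)
    covering : ∀ x → points W₀ x → Covered σ x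
    covering x x∈W₀ = decidable-stable (covered? σ x) λ ¬covered → to (W₀-nonspecial x) x∈W₀ (to (C-special σ inA x) ¬covered)

  from-cover : ∀ σ → StableCover (points W₀) σ → InA k (3 + j) σ
  from-cover σ (mkCover ne adm cov) = (ne , proj₁ special , adjacent) , λ x → mk⇔ (λ c → from label-values (in-C x c)) (λ l → C-in x (to label-values l))
    where
    special : ∃[ w ] (vset k w ≡ triple 0 1 (2 + j))
    special = vertex-of k (triple 0 1 (2 + j)) (triple-card (s≤s z≤n) (s≤s (s≤s z≤n)) (ℕP.m≤n⇒m≤1+n ℓ≤))
    adjacent : ∀ v → v ∈ σ → AdjS k v (proj₁ special)
    adjacent v v∈ = (λ y y∈v y∈w → to (W₀-nonspecial y) (proj₂ (adm v v∈) y y∈v)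
                                      (∈-select⁻ (λ x → Tri? 0 1 (2 + j) (toℕ x)) (subst (y ∈_) (proj₂ special) y∈w))) ,
                    inj₁ (proj₁ (adm v v∈))
    in-C : ∀ x → InC k x σ → Special x
    in-C x ¬covered = decidable-stable (Tri? 0 1 (2 + j) (toℕ x)) λ ¬special → ¬covered (cov x (from (W₀-nonspecial x) ¬special))
    C-in : ∀ x → Special x → InC k x σ
    C-in x special (v , v∈ , x∈v) = to (W₀-nonspecial x) (proj₂ (adm v v∈) x x∈v) special

  A-matchable : ∃[ M ] PerfectAcyclic (InA k (3 + j)) M
  A-matchable = let (M , pa) = matchable (suc (size (points? W₀))) W₀ (complement-valid j (5 + k) ℓ≤) ℕP.≤-refl
                in M , transfer from-cover to-cover pa

proposition3p3 : ∀ (k ℓ : ℕ) → 1 ≤ k → 3 ≤ ℓ → ℓ ≤ k + 5 →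
    ∃[ M ] (IsMatching k (InA k ℓ) M × IsAcyclic k (InA k ℓ) M × IsPerfect k (InA k ℓ) M)
proposition3p3 k (suc (suc (suc j))) _ (s≤s (s≤s (s≤s z≤n))) ℓ≤k+5 = M , matching , acyclic , perfect
  where
  open Identification k j (subst (3 + j ≤_) (ℕP.+-comm k 5) ℓ≤k+5)
  M = proj₁ A-matchable
  open Matchings.PerfectAcyclic (proj₂ A-matchable)
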